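{- Let $\Bbbk$ be a field of characteristic different from $2$, $V$ a $\Bbbk$-vector space with an involution $v\mapsto\bar v$ extended to $T(V)$ by $\overline{v_1\cdots v_n}=\bar v_n\cdots\bar v_1$. Let $p_1,\dots,p_k$ be homogeneous Lie polynomials and $n=\sum_{i=1}^k\deg(p_i)$. Then $$(p_1\cdots p_k)\cdot X_{(0,n)}=\nabla\Big(\cdots\nabla\big(\nabla(p_1)p_2\big)p_3\cdots p_k\Big),$$ where $\nabla(a)=a+\bar a$. In particular, if $\bar p_1=-p_1$, then $(p_1\cdots p_k)\cdot X_{(0,n)}=0$.
   Context: $T(V)=\bigoplus_m V^{\otimes m}$ is the tensor algebra with $\Delta(v)=1\otimes v+v\otimes1$ ($v\in V$); Lie polynomials are primitive elements of $T(V)$. $B_n$ is the group of signed permutations (bijections $\sigma$ of $\{\pm1,\dots,\pm n\}$ with $\sigma(-i)=-\sigma(i)$); it acts on $V^{\otimes n}$ on the right by $(v_1\cdots v_n)\cdot\sigma=v^{\pm}_{\sigma(1)}\cdots v^{\pm}_{\sigma(n)}$ where $v^\pm_{\sigma(i)}=v_{\sigma(i)}$ if $\sigma(i)>0$ and $=\bar v_{ -\sigma(i)}$ if $\sigma(i)<0$; extended linearly to $\Bbbk B_n$. With $\sigma(0)=0$ and $\mathrm{Des}(\sigma)=\{i\in\{0,\dots,n-1\}:\sigma(i)>\sigma(i+1)\}$, $X_{(0,n)}=\sum\{\sigma\in B_n:\mathrm{Des}(\sigma)\subseteq\{0\}\}$. -}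

module Defs where

open import Level using (Level; _⊔_)
open import Data.Bool using (Bool; true; false)
open import Data.Nat as ℕ using (ℕ; zero; suc)
open import Data.Fin as Fin using (Fin)
open import Data.Integer as ℤ using (ℤ)
open import Data.Product using (_×_; _,_; Σ; ∃; proj₁; proj₂)
open import Data.List as List using (List; []; _∷_; _++_; map; concatMap; foldl; filter; length)
open import Data.Vec as Vec using (Vec)
open import Data.List.Relation.Unary.All using (All)
open import Data.List.Relation.Unary.AllPairs using (AllPairs; allPairs?)
open import Data.List.Relation.Unary.Linked using (Linked; linked?)
open import Relation.Nullary using (¬_; Dec; yes; no)
open import Relation.Nullary.Decidable using (¬?; _×-dec_)
open import Relation.Binary.PropositionalEquality using (_≡_; _≢_) renaming (sym to ≡-sym)
open import Algebra.Bundles using (CommutativeRing)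
open import Algebra.Module.Bundles using (Module)

record IsField {c ℓ : Level} (R : CommutativeRing c ℓ) : Set (c ⊔ ℓ) where
  open CommutativeRing R
  field
    nontrivial : ¬ (1# ≈ 0#)
    inverse    : ∀ x → ¬ (x ≈ 0#) → ∃ λ y → x * y ≈ 1#

CharNot2 : {c ℓ : Level} (R : CommutativeRing c ℓ) → Set ℓ
CharNot2 R = ¬ (1# + 1# ≈ 0#) where open CommutativeRing R

-- Signed permutations B_n.  σ is stored as the vector (σ(1),…,σ(n)),
-- each entry being a sign (true = positive) and an absolute value
-- |σ(i)| ∈ {1,…,n} encoded as Fin n (Fin.zero ↦ 1).

SVal : ℕ → Set
SVal n = Bool × Fin n

absS : ∀ {n} → SVal n → Fin n
absS = proj₂

valS : ∀ {n} → SVal n → ℤ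
valS (true  , j) = ℤ.+ (suc (Fin.toℕ j))
valS (false , j) = ℤ.- (ℤ.+ (suc (Fin.toℕ j)))

allVecs : {A : Set} → List A → (n : ℕ) → List (Vec A n)
allVecs xs zero    = Vec.[] ∷ []
allVecs xs (suc n) = concatMap (λ x → map (x Vec.∷_) (allVecs xs n)) xs

allSVal : (n : ℕ) → List (SVal n)
allSVal n = concatMap (λ b → map (b ,_) (List.allFin n)) (true ∷ false ∷ [])

IsSignedPerm : ∀ {n} → Vec (SVal n) n → Set
IsSignedPerm σ = AllPairs _≢_ (List.map absS (Vec.toList σ))

isSignedPerm? : ∀ {n} (σ : Vec (SVal n) n) → Dec (IsSignedPerm σ)
isSignedPerm? σ = allPairs? (λ x y → ¬? (x Fin.≟ y)) _

-- Des(σ) ⊆ {0}: no descent at i ∈ {1,…,n-1}, i.e. σ(i) ≤ σ(i+1) for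
-- consecutive entries (position 0, with σ(0)=0, is unconstrained).
DesSub0 : ∀ {n} → Vec (SVal n) n → Set
DesSub0 σ = Linked ℤ._≤_ (List.map valS (Vec.toList σ))

desSub0? : ∀ {n} (σ : Vec (SVal n) n) → Dec (DesSub0 σ)
desSub0? σ = linked? ℤ._≤?_ _

X0-set : (n : ℕ) → List (Vec (SVal n) n)
X0-set n = filter (λ σ → isSignedPerm? σ ×-dec desSub0? σ) (allVecs (allSVal n) n)

-- The tensor algebra T(V) (and its tensor powers T(V)^{⊗k}) as formal
-- linear combinations of (tuples of) words in V, modulo the congruence
-- generated by commutativity of formal sums, collection of scalars and
-- multilinearity in every tensor slot.

module TensorAlgebra {c ℓ m ℓm : Level} (R : CommutativeRing c ℓ) (M : Module R m ℓm) where

  open CommutativeRing R renaming (Carrier to K)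
  open Module M renaming (Carrierᴹ to V)

  Word : Set m
  Word = List V

  FT : ℕ → Set (c ⊔ m)
  FT k = List (K × Vec Word k)

  data PointwiseW : Word → Word → Set (m ⊔ ℓm) where
    []  : PointwiseW [] []
    _∷_ : ∀ {x y u v} → x ≈ᴹ y → PointwiseW u v → PointwiseW (x ∷ u) (y ∷ v)

  infix 4 _∼_
  data _∼_ {k : ℕ} : FT k → FT k → Set (c ⊔ ℓ ⊔ m ⊔ ℓm) where
    ∼-refl  : ∀ {a} → a ∼ a
    ∼-sym   : ∀ {a b} → a ∼ b → b ∼ a
    ∼-trans : ∀ {a b d} → a ∼ b → b ∼ d → a ∼ d
    ∼-++    : ∀ {a a′ b b′} → a ∼ a′ → b ∼ b′ → a ++ b ∼ a′ ++ b′
    ∼-comm  : ∀ a b → a ++ b ∼ b ++ a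
    ∼-zero  : ∀ ws → (0# , ws) ∷ [] ∼ []
    ∼-add   : ∀ r s ws → (r , ws) ∷ (s , ws) ∷ [] ∼ (r + s , ws) ∷ []
    ∼-scal  : ∀ {r s} ws → r ≈ s → (r , ws) ∷ [] ∼ (s , ws) ∷ []
    ∼-letters : ∀ r ws j w′ → PointwiseW (Vec.lookup ws j) w′ →
                (r , ws) ∷ [] ∼ (r , Vec.updateAt ws j (λ _ → w′)) ∷ []
    ∼-lin+  : ∀ r ws j u x y v →
              (r , Vec.updateAt ws j (λ _ → u ++ (x +ᴹ y) ∷ v)) ∷ []
              ∼ (r , Vec.updateAt ws j (λ _ → u ++ x ∷ v)) ∷
                (r , Vec.updateAt ws j (λ _ → u ++ y ∷ v)) ∷ []
    ∼-lin*  : ∀ r ws j u s x v →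
              (r , Vec.updateAt ws j (λ _ → u ++ (s *ₗ x) ∷ v)) ∷ []
              ∼ (r * s , Vec.updateAt ws j (λ _ → u ++ x ∷ v)) ∷ []

  T : Set (c ⊔ m)
  T = FT 1

  word : K → Word → T
  word r w = (r , w Vec.∷ Vec.[]) ∷ []

  0T : T
  0T = []

  1T : T
  1T = word 1# []

  _+T_ : T → T → T
  _+T_ = _++_

  -T_ : T → T
  -T_ = map (λ { (r , ws) → (- r , ws) })

  termWord : K × Vec Word 1 → Word
  termWord (_ , w Vec.∷ Vec.[]) = w

  _*T_ : T → T → T
  a *T b = concatMap (λ { (r , w Vec.∷ Vec.[]) →
             map (λ { (s , w′ Vec.∷ Vec.[]) → (r * s , (w ++ w′) Vec.∷ Vec.[]) }) b }) a

  Homogeneous : ℕ → T → Set (c ⊔ m)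
  Homogeneous d p = All (λ t → length (termWord t) ≡ d) p

  -- coproduct Δ : T(V) → T(V) ⊗ T(V), the algebra map with Δ v = 1⊗v + v⊗1
  -- (on a word: sum over all splittings into a subword and its complement)
  Δw : Word → FT 2
  Δw [] = (1# , [] Vec.∷ [] Vec.∷ Vec.[]) ∷ []
  Δw (x ∷ w) = concatMap (λ { (r , a Vec.∷ b Vec.∷ Vec.[]) →
                 (r , (x ∷ a) Vec.∷ b Vec.∷ Vec.[]) ∷
                 (r , a Vec.∷ (x ∷ b) Vec.∷ Vec.[]) ∷ [] }) (Δw w)

  Δ : T → FT 2
  Δ = concatMap (λ { (r , w Vec.∷ Vec.[]) →
        map (λ { (s , ws) → (r * s , ws) }) (Δw w) })

  prim-rhs : T → FT 2
  prim-rhs p = map (λ { (r , w Vec.∷ Vec.[]) → (r , w Vec.∷ [] Vec.∷ Vec.[]) }) p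
            ++ map (λ { (r , w Vec.∷ Vec.[]) → (r , [] Vec.∷ w Vec.∷ Vec.[]) }) p

  -- Lie polynomial = primitive element of T(V)
  IsLiePoly : T → Set (c ⊔ ℓ ⊔ m ⊔ ℓm)
  IsLiePoly p = Δ p ∼ prim-rhs p

  module WithInvolution (bar : V → V) where

    barT : T → T
    barT = map (λ { (r , w Vec.∷ Vec.[]) → (r , List.reverse (map bar w) Vec.∷ Vec.[]) })

    ∇ : T → T
    ∇ a = a +T barT a

    -- right action of σ ∈ B_n on a word of length n:
    -- position i receives v_{σ(i)} if σ(i) > 0, and \bar v_{-σ(i)} if σ(i) < 0.
    -- (Words of other lengths are sent to 0; only degree n is ever acted on.)
    actWord : ∀ {n} → Vec (SVal n) n → Word → T
    actWord {n} σ w with length w ℕ.≟ n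
    ... | no  _  = 0T
    ... | yes eq = word 1# (Vec.toList (Vec.map letter σ))
      where
        letter : SVal n → V
        letter (true  , j) = List.lookup w (Fin.cast (≡-sym eq) j)
        letter (false , j) = bar (List.lookup w (Fin.cast (≡-sym eq) j))

    act : ∀ {n} → T → Vec (SVal n) n → T
    act p σ = concatMap (λ { (r , w Vec.∷ Vec.[]) →
                map (λ { (s , ws) → (r * s , ws) }) (actWord σ w) }) p

    actX0 : (n : ℕ) → T → T
    actX0 n p = concatMap (act p) (X0-set n)

    prodList : T → List T → T
    prodList p₁ ps = foldl _*T_ p₁ ps

    nested∇ : T → List T → T
    nested∇ p₁ ps = foldl (λ acc p → ∇ (acc *T p)) (∇ p₁) ps

record IsLinearInvolution {c ℓ m ℓm : Level} (R : CommutativeRing c ℓ) (M : Module R m ℓm)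
         (bar : Module.Carrierᴹ M → Module.Carrierᴹ M) : Set (c ⊔ m ⊔ ℓm) where
  open CommutativeRing R using (Carrier)
  open Module M
  field
    bar-cong : ∀ {x y} → x ≈ᴹ y → bar x ≈ᴹ bar y
    bar-+    : ∀ x y → bar (x +ᴹ y) ≈ᴹ bar x +ᴹ bar y
    bar-*    : ∀ (r : Carrier) x → bar (r *ₗ x) ≈ᴹ r *ₗ bar x
    bar-bar  : ∀ x → bar (bar x) ≈ᴹ x

-- A signed permutation σ with Des(σ) ⊆ {0} is determined by the set S of indices it negates:
-- it lists −i for i ∈ S with i decreasing, then the remaining i increasingly.  Acting on a word
-- w, it therefore yields x̄ y, where x is the subword of w indexed by S and y the complementary
-- subword.  Summing over S, p · X_(0,n) = μ (bar ⊗ id) Δ p =: (bar ⋆ id) p for homogeneous p of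
-- degree n.  If q is primitive, Δ q = q ⊗ 1 + 1 ⊗ q gives (bar ⋆ id) q = ∇ q, and
-- Δ (a q) = Δ a · (q ⊗ 1 + 1 ⊗ q) gives (bar ⋆ id) (a q) = (bar ⋆ id) a · q + q̄ · (bar ⋆ id) a.
-- Elements N = ∇ (…) are self-conjugate, so q̄ N is the conjugate of N q and the recursion becomes
-- N ↦ ∇ (N q), which is the nested ∇.  If p̄₁ = −p₁ the innermost ∇ p₁ vanishes.

module Submission where

open import Defs
open import Level using (Level; _⊔_)
open import Data.Bool using (Bool; true; false)
import Data.Bool.Properties as Boolₚ
open import Data.Nat as ℕ using (ℕ; zero; suc)
import Data.Nat.Properties as ℕₚ
open import Data.Integer as ℤ using (ℤ)
import Data.Integer.Properties as ℤₚ
open import Data.Fin as Fin using (Fin)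
import Data.Fin.Properties as Finₚ
open import Data.Product using (_×_; _,_; proj₁; proj₂; uncurry)
import Data.Product.Properties as Productₚ
open import Data.Sum using (_⊎_; inj₁; inj₂)
open import Data.Empty using (⊥-elim)
open import Data.List as List using (List; []; _∷_; _++_; map; concatMap; length; foldl; foldr)
import Data.List.Properties as Listₚ
open import Data.Vec as Vec using (Vec; []; _∷_)
import Data.Vec.Properties as Vecₚ
open import Data.List.Relation.Unary.All as All using (All; []; _∷_)
import Data.List.Relation.Unary.All.Properties as Allₚ
open import Data.List.Relation.Unary.Any as Any using (here; there)
open import Data.List.Relation.Unary.AllPairs as AllPairs using (AllPairs; []; _∷_)
import Data.List.Relation.Unary.AllPairs.Properties as AllPairsₚ
open import Data.List.Relation.Unary.Linked as Linked using (Linked; []; [-]; _∷_)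
import Data.List.Relation.Unary.Linked.Properties as Linkedₚ
open import Data.List.Relation.Unary.Unique.Propositional using (Unique)
import Data.List.Relation.Unary.Unique.Propositional.Properties as Uniqueₚ
open import Data.List.Membership.Propositional using (_∈_; _∉_; find)
import Data.List.Membership.Propositional.Properties as ∈ₚ
import Data.List.Membership.DecPropositional as DecMembership
open import Data.List.Membership.Propositional.Properties.WithK using (unique∧set⇒bag)
open import Data.List.Relation.Binary.BagAndSetEquality using (∼bag⇒↭)
open import Data.List.Relation.Binary.Permutation.Propositional as ↭ using (_↭_)
open import Function using (_∘_; mk⇔)
open import Relation.Binary.PropositionalEquality
  using (_≡_; _≢_; refl; sym; trans; cong; cong₂; subst; subst₂)
open import Relation.Binary.Bundles using (Setoid)
import Relation.Binary.Reasoning.Setoid as SetoidReasoning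
open import Relation.Nullary using (¬_; Dec; does; yes; no)
open import Algebra.Bundles using (CommutativeRing)
open import Algebra.Module.Bundles using (Module)

private
  variable
    a b r s ℓ₀ : Level
    A : Set a
    B : Set b
    C : Set ℓ₀

∈-concatMap⁺′ : {g : A → List B} {x : A} {xs : List A} {y : B} →
                x ∈ xs → y ∈ g x → y ∈ concatMap g xs
∈-concatMap⁺′ {g = g} x∈ y∈ = ∈ₚ.∈-concatMap⁺ g (Any.map (λ { refl → y∈ }) x∈)

concatMap-concatMap : (f : B → List C) (g : A → List B) → ∀ xs →
                      concatMap f (concatMap g xs) ≡ concatMap (concatMap f ∘ g) xs
concatMap-concatMap f g []       = refl
concatMap-concatMap f g (x ∷ xs) =
  trans (Listₚ.concatMap-++ f (g x) (concatMap g xs)) (cong (concatMap f (g x) ++_) (concatMap-concatMap f g xs))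

Unique-concatMap⁺ : (g : A → List B) {xs : List A} → Unique xs → (∀ x → Unique (g x)) →
                    (∀ {x y z} → z ∈ g x → z ∈ g y → x ≡ y) → Unique (concatMap g xs)
Unique-concatMap⁺ g {[]}     _        _  _        = []
Unique-concatMap⁺ g {x ∷ xs} (x≢ ∷ u) ug disjoint =
  Uniqueₚ.++⁺ (ug x) (Unique-concatMap⁺ g u ug disjoint) λ (z∈gx , z∈rest) →
    let y , y∈ , z∈gy = find (∈ₚ.∈-concatMap⁻ g z∈rest) in All.lookup x≢ y∈ (disjoint z∈gx z∈gy)

map-unique⇒injective : {f : A → B} {xs : List A} → Unique (map f xs) →
                       ∀ {x y} → x ∈ xs → y ∈ xs → f x ≡ f y → x ≡ y
map-unique⇒injective _ (here refl) (here refl) _ = refl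
map-unique⇒injective {f = f} (fx≢ ∷ _) (here refl) (there y∈) e = ⊥-elim (All.lookup fx≢ (∈ₚ.∈-map⁺ f y∈) e)
map-unique⇒injective {f = f} (fx≢ ∷ _) (there x∈) (here refl) e =
  ⊥-elim (All.lookup fx≢ (∈ₚ.∈-map⁺ f x∈) (sym e))
map-unique⇒injective (_ ∷ u) (there x∈) (there y∈) e = map-unique⇒injective u x∈ y∈ e

lookup-injective : {xs : List A} → Unique xs → ∀ {i j} → List.lookup xs i ≡ List.lookup xs j → i ≡ j
lookup-injective (_  ∷ _) {Fin.zero}  {Fin.zero}  _ = refl
lookup-injective (x≢ ∷ _) {Fin.zero}  {Fin.suc j} e = ⊥-elim (All.lookup x≢ (∈ₚ.∈-lookup j) e)
lookup-injective (x≢ ∷ _) {Fin.suc i} {Fin.zero}  e = ⊥-elim (All.lookup x≢ (∈ₚ.∈-lookup i) (sym e))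
lookup-injective (_  ∷ u) {Fin.suc i} {Fin.suc j} e = cong Fin.suc (lookup-injective u e)

-- Pigeonhole: leaving out i would inject Fin (length xs) into Fin (n − 1).
unique-complete : ∀ {n} {xs : List (Fin n)} → Unique xs → length xs ≡ n → ∀ i → i ∈ xs
unique-complete {suc n} {xs} u |xs| i with DecMembership._∈?_ Finₚ._≟_ i xs
... | yes i∈ = i∈
... | no  i∉ = ⊥-elim (ℕₚ.<-irrefl refl (subst (ℕ._≤ n) |xs| (Finₚ.injective⇒≤ {f = f} f-injective)))
  where
    i≢ : ∀ k → i ≢ List.lookup xs k
    i≢ k refl = i∉ (∈ₚ.∈-lookup k)
    f : Fin (length xs) → Fin n
    f k = Fin.punchOut (i≢ k)
    f-injective : ∀ {k k′} → f k ≡ f k′ → k ≡ k′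
    f-injective {k} {k′} = lookup-injective u ∘ Finₚ.punchOut-injective (i≢ k) (i≢ k′)

AllPairs-map∈ : {R : A → A → Set r} {S : A → A → Set s} {xs : List A} →
                (∀ {x y} → x ∈ xs → y ∈ xs → R x y → S x y) → AllPairs R xs → AllPairs S xs
AllPairs-map∈ f []       = []
AllPairs-map∈ f (r ∷ rs) =
  All.tabulate (λ y∈ → f (here refl) (there y∈) (All.lookup r y∈))
    ∷ AllPairs-map∈ (λ x∈ y∈ → f (there x∈) (there y∈)) rs

sorted-unique : {_<_ : A → A → Set r} → (∀ {x y} → x < y → ¬ y < x) →
                ∀ {xs ys} → AllPairs _<_ xs → AllPairs _<_ ys →
                (∀ {z} → z ∈ xs → z ∈ ys) → (∀ {z} → z ∈ ys → z ∈ xs) → xs ≡ ys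
sorted-unique asym {[]}    {[]}    _ _ _ _ = refl
sorted-unique asym {[]}    {_ ∷ _} _ _ _ ⊇ with () ← ⊇ (here refl)
sorted-unique asym {_ ∷ _} {[]}    _ _ ⊆ _ with () ← ⊆ (here refl)
sorted-unique {_<_ = _<_} asym {x ∷ xs} {y ∷ ys} (x< ∷ <xs) (y< ∷ <ys) ⊆ ⊇ =
  cong₂ _∷_ x≡y (sorted-unique asym <xs <ys (tail x≡y x< ⊆) (tail (sym x≡y) y< ⊇))
  where
    x≡y : x ≡ y
    x≡y with ⊆ (here refl) | ⊇ (here refl)
    ... | here e  | _       = e
    ... | there _ | here e  = sym e
    ... | there p | there q = ⊥-elim (asym (All.lookup y< p) (All.lookup x< q))
    tail : ∀ {u v us vs} → u ≡ v → All (u <_) us → (∀ {z} → z ∈ u ∷ us → z ∈ v ∷ vs) →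
           ∀ {z} → z ∈ us → z ∈ vs
    tail refl u< ⊆′ z∈ with ⊆′ (there z∈)
    ... | there q   = q
    ... | here refl = ⊥-elim (asym (All.lookup u< z∈) (All.lookup u< z∈))

∈-allVecs : {xs : List A} → (∀ x → x ∈ xs) → ∀ {n} (v : Vec A n) → v ∈ allVecs xs n
∈-allVecs all []      = here refl
∈-allVecs all (x ∷ v) = ∈-concatMap⁺′ (all x) (∈ₚ.∈-map⁺ (x ∷_) (∈-allVecs all v))

allVecs-unique : {xs : List A} → Unique xs → ∀ n → Unique (allVecs xs n)
allVecs-unique u zero    = [] ∷ []
allVecs-unique u (suc n) =
  Unique-concatMap⁺ _ u (λ _ → Uniqueₚ.map⁺ Vecₚ.∷-injectiveʳ (allVecs-unique u n))
    (λ z∈ z∈′ → trans (sym (head z∈)) (head z∈′))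
  where
    head : ∀ {x z} → z ∈ map (x ∷_) (allVecs _ n) → Vec.head z ≡ x
    head z∈ with _ , _ , refl ← ∈ₚ.∈-map⁻ _ z∈ = refl

module SignedPermutations where

  private
    variable
      n : ℕ

  sucS : SVal n → SVal (suc n)
  sucS (b , j) = (b , Fin.suc j)

  -- A subset c (c i = true: i is negated) determines the σ with Des(σ) ⊆ {0} and these
  -- negated values: −i for i ∈ c with i decreasing, then the i ∉ c increasingly.
  negEntries : Vec Bool n → List (SVal n)
  negEntries []          = []
  negEntries (true  ∷ c) = map sucS (negEntries c) ++ (false , Fin.zero) ∷ []
  negEntries (false ∷ c) = map sucS (negEntries c)

  posEntries : Vec Bool n → List (SVal n)
  posEntries []          = []
  posEntries (true  ∷ c) = map sucS (posEntries c)
  posEntries (false ∷ c) = (true , Fin.zero) ∷ map sucS (posEntries c)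

  entries : Vec Bool n → List (SVal n)
  entries c = negEntries c ++ posEntries c

  length-negEntries+posEntries : (c : Vec Bool n) → length (negEntries c) ℕ.+ length (posEntries c) ≡ n
  length-negEntries+posEntries [] = refl
  length-negEntries+posEntries (true ∷ c)
    rewrite Listₚ.length-++ (map sucS (negEntries c)) {(false , Fin.zero) ∷ []}
          | Listₚ.length-map sucS (negEntries c) | Listₚ.length-map sucS (posEntries c)
          | ℕₚ.+-comm (length (negEntries c)) 1
          = cong suc (length-negEntries+posEntries c)
  length-negEntries+posEntries (false ∷ c)
    rewrite Listₚ.length-map sucS (negEntries c) | Listₚ.length-map sucS (posEntries c)
          | ℕₚ.+-suc (length (negEntries c)) (length (posEntries c))
          = cong suc (length-negEntries+posEntries c)

  length-entries : (c : Vec Bool n) → length (entries c) ≡ n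
  length-entries c = trans (Listₚ.length-++ (negEntries c)) (length-negEntries+posEntries c)

  fromSubset : Vec Bool n → Vec (SVal n) n
  fromSubset c = Vec.cast (length-entries c) (Vec.fromList (entries c))

  toList-fromSubset : (c : Vec Bool n) → Vec.toList (fromSubset c) ≡ entries c
  toList-fromSubset c =
    trans (Vecₚ.toList-cast (length-entries c) (Vec.fromList (entries c))) (Vecₚ.toList∘fromList (entries c))

  ∈-map-sucS⁻ : ∀ {b} {j : Fin n} {xs} → (b , Fin.suc j) ∈ map sucS xs → (b , j) ∈ xs
  ∈-map-sucS⁻ {xs = _ ∷ _} (here refl) = here refl
  ∈-map-sucS⁻ {xs = _ ∷ _} (there p)   = there (∈-map-sucS⁻ p)

  zero∉map-sucS : ∀ {b} {xs : List (SVal n)} → (b , Fin.zero) ∉ map sucS xs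
  zero∉map-sucS {xs = _ ∷ _} (there p) = zero∉map-sucS p

  ∈-negEntries⁻ : (c : Vec Bool n) → ∀ {b i} → (b , i) ∈ negEntries c → b ≡ false × Vec.lookup c i ≡ true
  ∈-negEntries⁻ (true ∷ c) {i = Fin.zero} p with ∈ₚ.∈-++⁻ (map sucS (negEntries c)) p
  ... | inj₁ q           = ⊥-elim (zero∉map-sucS q)
  ... | inj₂ (here refl) = refl , refl
  ∈-negEntries⁻ (true ∷ c) {i = Fin.suc i} p with ∈ₚ.∈-++⁻ (map sucS (negEntries c)) p
  ... | inj₁ q         = ∈-negEntries⁻ c (∈-map-sucS⁻ q)
  ... | inj₂ (here ())
  ∈-negEntries⁻ (false ∷ c) {i = Fin.zero}  p = ⊥-elim (zero∉map-sucS p)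
  ∈-negEntries⁻ (false ∷ c) {i = Fin.suc i} p = ∈-negEntries⁻ c (∈-map-sucS⁻ p)

  ∈-negEntries⁺ : (c : Vec Bool n) → ∀ i → Vec.lookup c i ≡ true → (false , i) ∈ negEntries c
  ∈-negEntries⁺ (true  ∷ c) Fin.zero    _ = ∈ₚ.∈-++⁺ʳ (map sucS (negEntries c)) (here refl)
  ∈-negEntries⁺ (true  ∷ c) (Fin.suc i) e = ∈ₚ.∈-++⁺ˡ (∈ₚ.∈-map⁺ sucS (∈-negEntries⁺ c i e))
  ∈-negEntries⁺ (false ∷ c) (Fin.suc i) e = ∈ₚ.∈-map⁺ sucS (∈-negEntries⁺ c i e)

  ∈-posEntries⁻ : (c : Vec Bool n) → ∀ {b i} → (b , i) ∈ posEntries c → b ≡ true × Vec.lookup c i ≡ false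
  ∈-posEntries⁻ (true  ∷ c) {i = Fin.zero}  p           = ⊥-elim (zero∉map-sucS p)
  ∈-posEntries⁻ (true  ∷ c) {i = Fin.suc i} p           = ∈-posEntries⁻ c (∈-map-sucS⁻ p)
  ∈-posEntries⁻ (false ∷ c) {i = Fin.zero}  (here refl) = refl , refl
  ∈-posEntries⁻ (false ∷ c) {i = Fin.zero}  (there p)   = ⊥-elim (zero∉map-sucS p)
  ∈-posEntries⁻ (false ∷ c) {i = Fin.suc i} (there p)   = ∈-posEntries⁻ c (∈-map-sucS⁻ p)

  ∈-posEntries⁺ : (c : Vec Bool n) → ∀ i → Vec.lookup c i ≡ false → (true , i) ∈ posEntries c
  ∈-posEntries⁺ (true  ∷ c) (Fin.suc i) e = ∈ₚ.∈-map⁺ sucS (∈-posEntries⁺ c i e)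
  ∈-posEntries⁺ (false ∷ c) Fin.zero    _ = here refl
  ∈-posEntries⁺ (false ∷ c) (Fin.suc i) e = there (∈ₚ.∈-map⁺ sucS (∈-posEntries⁺ c i e))

  ∈-entries⁻ : (c : Vec Bool n) → ∀ {b i} → (b , i) ∈ entries c →
               b ≡ false × Vec.lookup c i ≡ true ⊎ b ≡ true × Vec.lookup c i ≡ false
  ∈-entries⁻ c p with ∈ₚ.∈-++⁻ (negEntries c) p
  ... | inj₁ q = inj₁ (∈-negEntries⁻ c q)
  ... | inj₂ q = inj₂ (∈-posEntries⁻ c q)

  -- A record rather than a synonym, so that x and y can be inferred from a proof.
  record _<S_ (x y : SVal n) : Set where
    constructor valS<
    field valS-< : valS x ℤ.< valS y
  open _<S_

  <S-irrefl : {x : SVal n} → ¬ x <S x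
  <S-irrefl (valS< p) = ℤₚ.<-irrefl refl p

  <S-asym : {x y : SVal n} → x <S y → ¬ y <S x
  <S-asym (valS< p) (valS< q) = ℤₚ.<-asym p q

  <S-trans : {x y z : SVal n} → x <S y → y <S z → x <S z
  <S-trans (valS< p) (valS< q) = valS< (ℤₚ.<-trans p q)

  sucS-mono : {x y : SVal n} → x <S y → sucS x <S sucS y
  sucS-mono {x = true  , _} {true  , _} (valS< (ℤ.+<+ p)) = valS< (ℤ.+<+ (ℕ.s<s p))
  sucS-mono {x = false , _} {false , _} (valS< (ℤ.-<- p)) = valS< (ℤ.-<- (ℕ.s<s p))
  sucS-mono {x = false , _} {true  , _} (valS< ℤ.-<+)     = valS< ℤ.-<+

  map-sucS-sorted : {xs : List (SVal n)} → AllPairs _<S_ xs → AllPairs _<S_ (map sucS xs)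
  map-sucS-sorted = AllPairsₚ.map⁺ ∘ AllPairs.map sucS-mono

  negEntries-negative : (c : Vec Bool n) → All (λ x → proj₁ x ≡ false) (negEntries c)
  negEntries-negative c = All.tabulate (proj₁ ∘ ∈-negEntries⁻ c)

  posEntries-positive : (c : Vec Bool n) → All (λ x → proj₁ x ≡ true) (posEntries c)
  posEntries-positive c = All.tabulate (proj₁ ∘ ∈-posEntries⁻ c)

  negEntries-sorted : (c : Vec Bool n) → AllPairs _<S_ (negEntries c)
  negEntries-sorted []          = []
  negEntries-sorted (true  ∷ c) =
    AllPairsₚ.++⁺ (map-sucS-sorted (negEntries-sorted c)) ([] ∷ []) (Allₚ.map⁺ (All.map <−1 (negEntries-negative c)))
    where
      <−1 : ∀ {x} → proj₁ x ≡ false → All (sucS x <S_) ((false , Fin.zero) ∷ [])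
      <−1 {false , _} refl = valS< (ℤ.-<- (ℕ.s≤s ℕ.z≤n)) ∷ []
  negEntries-sorted (false ∷ c) = map-sucS-sorted (negEntries-sorted c)

  posEntries-sorted : (c : Vec Bool n) → AllPairs _<S_ (posEntries c)
  posEntries-sorted []          = []
  posEntries-sorted (true  ∷ c) = map-sucS-sorted (posEntries-sorted c)
  posEntries-sorted (false ∷ c) =
    Allₚ.map⁺ (All.map 1< (posEntries-positive c)) ∷ map-sucS-sorted (posEntries-sorted c)
    where
      1< : ∀ {x} → proj₁ x ≡ true → (true , Fin.zero) <S sucS x
      1< {true , _} refl = valS< (ℤ.+<+ (ℕ.s≤s (ℕ.s≤s ℕ.z≤n)))

  entries-sorted : (c : Vec Bool n) → AllPairs _<S_ (entries c)
  entries-sorted c = AllPairsₚ.++⁺ (negEntries-sorted c) (posEntries-sorted c)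
    (All.map (λ x⁻ → All.map (neg<pos x⁻) (posEntries-positive c)) (negEntries-negative c))
    where
      neg<pos : ∀ {x y : SVal _} → proj₁ x ≡ false → proj₁ y ≡ true → x <S y
      neg<pos {false , _} {true , _} refl refl = valS< ℤ.-<+

  fromSubset-isSignedPerm : (c : Vec Bool n) → IsSignedPerm (fromSubset c)
  fromSubset-isSignedPerm c rewrite toList-fromSubset c =
    AllPairsₚ.map⁺ (AllPairs-map∈ distinct (entries-sorted c))
    where
      distinct : ∀ {x y} → x ∈ entries c → y ∈ entries c → x <S y → absS x ≢ absS y
      distinct {b , i} {b′ , .i} x∈ y∈ x<y refl with ∈-entries⁻ c x∈ | ∈-entries⁻ c y∈
      ... | inj₁ (refl , _) | inj₁ (refl , _) = <S-irrefl x<y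
      ... | inj₂ (refl , _) | inj₂ (refl , _) = <S-irrefl x<y
      ... | inj₁ (_ , e)    | inj₂ (_ , e′)   with () ← trans (sym e) e′
      ... | inj₂ (_ , e)    | inj₁ (_ , e′)   with () ← trans (sym e) e′

  fromSubset-desSub0 : (c : Vec Bool n) → DesSub0 (fromSubset c)
  fromSubset-desSub0 c rewrite toList-fromSubset c =
    Linked.map ℤₚ.<⇒≤ (Linkedₚ.AllPairs⇒Linked (AllPairsₚ.map⁺ (AllPairs.map valS-< (entries-sorted c))))

  valS-injective : {x y : SVal n} → valS x ≡ valS y → x ≡ y
  valS-injective {x = true  , _} {true  , _} e =
    cong (true ,_) (Finₚ.toℕ-injective (ℕₚ.suc-injective (cong ℤ.∣_∣ e)))
  valS-injective {x = false , _} {false , _} e =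
    cong (false ,_) (Finₚ.toℕ-injective (ℕₚ.suc-injective (cong ℤ.∣_∣ e)))
  valS-injective {x = true  , _} {false , _} ()
  valS-injective {x = false , _} {true  , _} ()

  X0-sorted : (σ : Vec (SVal n) n) → IsSignedPerm σ → DesSub0 σ → AllPairs _<S_ (Vec.toList σ)
  X0-sorted σ perm des = Linkedₚ.Linked⇒AllPairs <S-trans (strict (Linkedₚ.map⁻ des) (AllPairsₚ.map⁻ perm))
    where
      strict : ∀ {xs} → Linked (λ x y → valS x ℤ.≤ valS y) xs → AllPairs (λ x y → absS x ≢ absS y) xs →
               Linked _<S_ xs
      strict []  _ = []
      strict [-] _ = [-]
      strict {x ∷ y ∷ _} (x≤y ∷ ≤s) ((x≢y ∷ _) ∷ ≢s) =
        valS< (ℤₚ.≤∧≢⇒< x≤y (x≢y ∘ cong absS ∘ valS-injective {x = x} {y})) ∷ strict ≤s ≢s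

  negated? : (σ : Vec (SVal n) n) → ∀ i → Dec ((false , i) ∈ Vec.toList σ)
  negated? σ i = DecMembership._∈?_ (Productₚ.≡-dec Boolₚ._≟_ Finₚ._≟_) (false , i) (Vec.toList σ)

  subsetOf : Vec (SVal n) n → Vec Bool n
  subsetOf σ = Vec.tabulate (does ∘ negated? σ)

  subsetOf-true⇒∈ : (σ : Vec (SVal n) n) → ∀ i → Vec.lookup (subsetOf σ) i ≡ true →
                    (false , i) ∈ Vec.toList σ
  subsetOf-true⇒∈ σ i e with negated? σ i | Vecₚ.lookup∘tabulate (does ∘ negated? σ) i
  ... | yes p | _  = p
  ... | no _  | e′ with () ← trans (sym e) e′

  subsetOf-false⇒∉ : (σ : Vec (SVal n) n) → ∀ i → Vec.lookup (subsetOf σ) i ≡ false →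
                     (false , i) ∉ Vec.toList σ
  subsetOf-false⇒∉ σ i e with negated? σ i | Vecₚ.lookup∘tabulate (does ∘ negated? σ) i
  ... | no p  | _  = p
  ... | yes _ | e′ with () ← trans (sym e) e′

  X0-fromSubset : (σ : Vec (SVal n) n) → IsSignedPerm σ → DesSub0 σ → σ ≡ fromSubset (subsetOf σ)
  X0-fromSubset σ perm des =
    trans (sym (Vecₚ.cast-is-id refl σ)) (Vecₚ.toList-injective refl σ (fromSubset c)
      (trans (sorted-unique <S-asym (X0-sorted σ perm des) (entries-sorted c) ⊆ ⊇) (sym (toList-fromSubset c))))
    where
      c = subsetOf σ
      |σ| : length (map absS (Vec.toList σ)) ≡ _
      |σ| = trans (Listₚ.length-map absS (Vec.toList σ)) (Vecₚ.length-toList σ)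
      ⊆ : ∀ {z} → z ∈ Vec.toList σ → z ∈ entries c
      ⊆ {false , i} z∈ with Vec.lookup c i in e
      ... | true  = ∈ₚ.∈-++⁺ˡ (∈-negEntries⁺ c i e)
      ... | false = ⊥-elim (subsetOf-false⇒∉ σ i e z∈)
      ⊆ {true  , i} z∈ with Vec.lookup c i in e
      ... | false = ∈ₚ.∈-++⁺ʳ (negEntries c) (∈-posEntries⁺ c i e)
      ... | true with () ← map-unique⇒injective perm z∈ (subsetOf-true⇒∈ σ i e) refl
      ⊇ : ∀ {z} → z ∈ entries c → z ∈ Vec.toList σ
      ⊇ {b , i} z∈ with ∈-entries⁻ c z∈
      ... | inj₁ (refl , e) = subsetOf-true⇒∈ σ i e
      ... | inj₂ (refl , e) with ∈ₚ.∈-map⁻ absS (unique-complete perm |σ| i)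
      ...   | (true  , _) , i∈ , refl = i∈
      ...   | (false , _) , i∈ , refl = ⊥-elim (subsetOf-false⇒∉ σ i e i∈)

  subsetOf-fromSubset : (c : Vec Bool n) → subsetOf (fromSubset c) ≡ c
  subsetOf-fromSubset c =
    trans (sym (Vecₚ.tabulate∘lookup _)) (trans (Vecₚ.tabulate-cong same) (Vecₚ.tabulate∘lookup c))
    where
      σ = fromSubset c
      same : ∀ i → Vec.lookup (subsetOf σ) i ≡ Vec.lookup c i
      same i with Vec.lookup (subsetOf σ) i in e | Vec.lookup c i in e′
      ... | true  | true  = refl
      ... | false | false = refl
      ... | true  | false with ∈-entries⁻ c (subst (_ ∈_) (toList-fromSubset c) (subsetOf-true⇒∈ σ i e))
      ...   | inj₁ (_ , e″) with () ← trans (sym e″) e′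
      same i | false | true =
        ⊥-elim (subsetOf-false⇒∉ σ i e
          (subst (_ ∈_) (sym (toList-fromSubset c)) (∈ₚ.∈-++⁺ˡ (∈-negEntries⁺ c i e′))))

  fromSubset-injective : {c c′ : Vec Bool n} → fromSubset c ≡ fromSubset c′ → c ≡ c′
  fromSubset-injective {c = c} {c′} e =
    trans (sym (subsetOf-fromSubset c)) (trans (cong subsetOf e) (subsetOf-fromSubset c′))

  bools : List Bool
  bools = true ∷ false ∷ []

  ∈-bools : ∀ b → b ∈ bools
  ∈-bools true  = here refl
  ∈-bools false = there (here refl)

  bools-unique : Unique bools
  bools-unique = ((λ ()) ∷ []) ∷ [] ∷ []

  ∈-allSVal : (x : SVal n) → x ∈ allSVal n
  ∈-allSVal {n} (b , j) =
    ∈-concatMap⁺′ {g = λ b → map (b ,_) (List.allFin n)} (∈-bools b) (∈ₚ.∈-map⁺ (b ,_) (∈ₚ.∈-allFin j))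

  allSVal-unique : ∀ n → Unique (allSVal n)
  allSVal-unique n =
    Unique-concatMap⁺ _ bools-unique (λ _ → Uniqueₚ.map⁺ (cong proj₂) (Uniqueₚ.allFin⁺ n))
      (λ z∈ z∈′ → trans (sym (sign z∈)) (sign z∈′))
    where
      sign : ∀ {b z} → z ∈ map (b ,_) (List.allFin n) → proj₁ z ≡ b
      sign z∈ with _ , _ , refl ← ∈ₚ.∈-map⁻ _ z∈ = refl

  X0-set↭fromSubsets : ∀ n → X0-set n ↭ map fromSubset (allVecs bools n)
  X0-set↭fromSubsets n = ∼bag⇒↭ (unique∧set⇒bag X0-unique fromSubsets-unique (mk⇔ ⊆ ⊇))
    where
      X0-unique : Unique (X0-set n)
      X0-unique = Uniqueₚ.filter⁺ _ (allVecs-unique (allSVal-unique n) n)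
      fromSubsets-unique : Unique (map fromSubset (allVecs bools n))
      fromSubsets-unique = Uniqueₚ.map⁺ fromSubset-injective (allVecs-unique bools-unique n)
      ⊆ : ∀ {σ} → σ ∈ X0-set n → σ ∈ map fromSubset (allVecs bools n)
      ⊆ {σ} σ∈ with _ , (perm , des) ← ∈ₚ.∈-filter⁻ _ {xs = allVecs (allSVal n) n} σ∈ =
        subst (_∈ _) (sym (X0-fromSubset σ perm des)) (∈ₚ.∈-map⁺ fromSubset (∈-allVecs ∈-bools (subsetOf σ)))
      ⊇ : ∀ {σ} → σ ∈ map fromSubset (allVecs bools n) → σ ∈ X0-set n
      ⊇ σ∈ with c , _ , refl ← ∈ₚ.∈-map⁻ fromSubset σ∈ =
        ∈ₚ.∈-filter⁺ _ (∈-allVecs ∈-allSVal (fromSubset c)) (fromSubset-isSignedPerm c , fromSubset-desSub0 c)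

module FormalSums {c ℓ m ℓm : Level} (R : CommutativeRing c ℓ) (M : Module R m ℓm) where

  open CommutativeRing R
    using (_≈_; _+_; _*_; -_; 0#; -‿inverseʳ; *-cong; *-comm; *-assoc; zeroˡ; zeroʳ; distribˡ; distribʳ)
    renaming (Carrier to K; refl to ≈-refl; sym to ≈-sym; trans to ≈-trans)
  open Module M using (_≈ᴹ_; _+ᴹ_; _*ₗ_; ≈ᴹ-refl) renaming (Carrierᴹ to V)
  open TensorAlgebra R M

  ∼-setoid : ℕ → Setoid (c ⊔ m) (c ⊔ ℓ ⊔ m ⊔ ℓm)
  ∼-setoid k = record
    { Carrier = FT k ; _≈_ = _∼_ ; isEquivalence = record { refl = ∼-refl ; sym = ∼-sym ; trans = ∼-trans } }

  open module ∼-Reasoning {k} = SetoidReasoning (∼-setoid k) public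

  ≡⇒∼ : ∀ {k} {a b : FT k} → a ≡ b → a ∼ b
  ≡⇒∼ refl = ∼-refl

  ++-congˡ : ∀ {k} (a : FT k) {b b′} → b ∼ b′ → a ++ b ∼ a ++ b′
  ++-congˡ a = ∼-++ ∼-refl

  ++-congʳ : ∀ {k} {a a′ : FT k} (b : FT k) → a ∼ a′ → a ++ b ∼ a′ ++ b
  ++-congʳ b a∼a′ = ∼-++ a∼a′ ∼-refl

  ++-interchange : ∀ {k} (a b d e : FT k) → (a ++ b) ++ (d ++ e) ∼ (a ++ d) ++ (b ++ e)
  ++-interchange a b d e = begin
    (a ++ b) ++ (d ++ e) ≡⟨ Listₚ.++-assoc a b (d ++ e) ⟩
    a ++ b ++ d ++ e     ≡⟨ cong (a ++_) (Listₚ.++-assoc b d e) ⟨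
    a ++ ((b ++ d) ++ e) ≈⟨ ++-congˡ a (++-congʳ e (∼-comm b d)) ⟩
    a ++ ((d ++ b) ++ e) ≡⟨ cong (a ++_) (Listₚ.++-assoc d b e) ⟩
    a ++ d ++ b ++ e     ≡⟨ Listₚ.++-assoc a d (b ++ e) ⟨
    (a ++ d) ++ (b ++ e) ∎

  module _ {k : ℕ} where

    concatMap-∼ : {f g : A → FT k} → (∀ x → f x ∼ g x) → ∀ xs → concatMap f xs ∼ concatMap g xs
    concatMap-∼ f∼g []       = ∼-refl
    concatMap-∼ f∼g (x ∷ xs) = ∼-++ (f∼g x) (concatMap-∼ f∼g xs)

    concatMap-const-[] : (xs : List A) → concatMap {B = K × Vec Word k} (λ _ → []) xs ≡ []
    concatMap-const-[] []       = refl
    concatMap-const-[] (_ ∷ xs) = concatMap-const-[] xs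

    concatMap-++-distrib : (f g : A → FT k) → ∀ xs →
                           concatMap (λ x → f x ++ g x) xs ∼ concatMap f xs ++ concatMap g xs
    concatMap-++-distrib f g []       = ∼-refl
    concatMap-++-distrib f g (x ∷ xs) =
      ∼-trans (++-congˡ (f x ++ g x) (concatMap-++-distrib f g xs)) (++-interchange (f x) (g x) _ _)

    concatMap-comm : (f : A → B → FT k) → ∀ xs ys →
                     concatMap (λ x → concatMap (f x) ys) xs ∼ concatMap (λ y → concatMap (λ x → f x y) xs) ys
    concatMap-comm f []       ys = ≡⇒∼ (sym (concatMap-const-[] ys))
    concatMap-comm f (x ∷ xs) ys =
      ∼-trans (++-congˡ (concatMap (f x) ys) (concatMap-comm f xs ys)) (∼-sym (concatMap-++-distrib (f x) _ ys))

    concatMap-↭ : (f : A → FT k) → ∀ {xs ys} → xs ↭ ys → concatMap f xs ∼ concatMap f ys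
    concatMap-↭ f ↭.refl        = ∼-refl
    concatMap-↭ f (↭.prep x p)  = ++-congˡ (f x) (concatMap-↭ f p)
    concatMap-↭ f (↭.trans p q) = ∼-trans (concatMap-↭ f p) (concatMap-↭ f q)
    concatMap-↭ f (↭.swap {xs} {ys} x y p) = begin
      f x ++ f y ++ concatMap f xs   ≡⟨ Listₚ.++-assoc (f x) (f y) _ ⟨
      (f x ++ f y) ++ concatMap f xs ≈⟨ ∼-++ (∼-comm (f x) (f y)) (concatMap-↭ f p) ⟩
      (f y ++ f x) ++ concatMap f ys ≡⟨ Listₚ.++-assoc (f y) (f x) _ ⟩
      f y ++ f x ++ concatMap f ys   ∎

  record IsLinear {k j : ℕ} (F : K × Vec Word k → FT j) : Set (c ⊔ ℓ ⊔ m ⊔ ℓm) where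
    field
      resp-zero    : ∀ ws → F (0# , ws) ∼ []
      resp-add     : ∀ r s ws → F (r , ws) ++ F (s , ws) ∼ F (r + s , ws)
      resp-scal    : ∀ {r s} ws → r ≈ s → F (r , ws) ∼ F (s , ws)
      resp-letters : ∀ r ws i w′ → PointwiseW (Vec.lookup ws i) w′ →
                     F (r , ws) ∼ F (r , Vec.updateAt ws i (λ _ → w′))
      resp-lin+    : ∀ r ws i u x y v →
                     F (r , Vec.updateAt ws i (λ _ → u ++ (x +ᴹ y) ∷ v))
                       ∼ F (r , Vec.updateAt ws i (λ _ → u ++ x ∷ v)) ++ F (r , Vec.updateAt ws i (λ _ → u ++ y ∷ v))
      resp-lin*    : ∀ r ws i u s x v →
                     F (r , Vec.updateAt ws i (λ _ → u ++ (s *ₗ x) ∷ v))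
                       ∼ F (r * s , Vec.updateAt ws i (λ _ → u ++ x ∷ v))
  open IsLinear

  concatMap-resp : ∀ {k j} {F : K × Vec Word k → FT j} → IsLinear F →
                   ∀ {a b} → a ∼ b → concatMap F a ∼ concatMap F b
  concatMap-resp {F = F} lin = go
    where
      single : ∀ {t} → F t ∼ concatMap F (t ∷ [])
      single {t} = ≡⇒∼ (sym (Listₚ.++-identityʳ (F t)))
      singles : ∀ {t t′} → F t ∼ F t′ → concatMap F (t ∷ []) ∼ concatMap F (t′ ∷ [])
      singles p = ∼-trans (∼-sym single) (∼-trans p single)
      go : ∀ {a b} → a ∼ b → concatMap F a ∼ concatMap F b
      go ∼-refl        = ∼-refl
      go (∼-sym p)     = ∼-sym (go p)
      go (∼-trans p q) = ∼-trans (go p) (go q)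
      go (∼-++ {a} {a′} {b} {b′} p q) = begin
        concatMap F (a ++ b)             ≡⟨ Listₚ.concatMap-++ F a b ⟩
        concatMap F a ++ concatMap F b   ≈⟨ ∼-++ (go p) (go q) ⟩
        concatMap F a′ ++ concatMap F b′ ≡⟨ Listₚ.concatMap-++ F a′ b′ ⟨
        concatMap F (a′ ++ b′)           ∎
      go (∼-comm a b) = begin
        concatMap F (a ++ b)             ≡⟨ Listₚ.concatMap-++ F a b ⟩
        concatMap F a ++ concatMap F b   ≈⟨ ∼-comm (concatMap F a) (concatMap F b) ⟩
        concatMap F b ++ concatMap F a   ≡⟨ Listₚ.concatMap-++ F b a ⟨
        concatMap F (b ++ a)             ∎
      go (∼-zero ws)             = ∼-trans (∼-sym single) (resp-zero lin ws)
      go (∼-add r s ws)          = ∼-trans (++-congˡ (F (r , ws)) (∼-sym single)) (∼-trans (resp-add lin r s ws) single)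
      go (∼-scal ws e)           = singles (resp-scal lin ws e)
      go (∼-letters r ws i w′ p) = singles (resp-letters lin r ws i w′ p)
      go (∼-lin+ r ws i u x y v) =
        ∼-trans (∼-sym single) (∼-trans (resp-lin+ lin r ws i u x y v) (++-congˡ (F _) single))
      go (∼-lin* r ws i u s x v) = singles (resp-lin* lin r ws i u s x v)

  module _ {k j : ℕ} where

    IsLinear-[] : IsLinear {k} {j} (λ _ → [])
    IsLinear-[] = record
      { resp-zero = λ _ → ∼-refl ; resp-add = λ _ _ _ → ∼-refl ; resp-scal = λ _ _ → ∼-refl
      ; resp-letters = λ _ _ _ _ _ → ∼-refl
      ; resp-lin+ = λ _ _ _ _ _ _ _ → ∼-refl ; resp-lin* = λ _ _ _ _ _ _ _ → ∼-refl }

    IsLinear-++ : {F G : K × Vec Word k → FT j} → IsLinear F → IsLinear G → IsLinear (λ t → F t ++ G t)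
    IsLinear-++ {F} {G} F-lin G-lin = record
      { resp-zero    = λ ws → ∼-++ (resp-zero F-lin ws) (resp-zero G-lin ws)
      ; resp-add     = λ r s ws → ∼-trans (++-interchange (F (r , ws)) (G (r , ws)) _ _)
                                          (∼-++ (resp-add F-lin r s ws) (resp-add G-lin r s ws))
      ; resp-scal    = λ ws e → ∼-++ (resp-scal F-lin ws e) (resp-scal G-lin ws e)
      ; resp-letters = λ r ws i w′ p → ∼-++ (resp-letters F-lin r ws i w′ p) (resp-letters G-lin r ws i w′ p)
      ; resp-lin+    = λ r ws i u x y v →
                         ∼-trans (∼-++ (resp-lin+ F-lin r ws i u x y v) (resp-lin+ G-lin r ws i u x y v))
                                 (++-interchange (F _) (F _) (G _) (G _))
      ; resp-lin*    = λ r ws i u s x v → ∼-++ (resp-lin* F-lin r ws i u s x v) (resp-lin* G-lin r ws i u s x v) }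

  IsLinear-concatMap : ∀ {k j} (G : B → K × Vec Word k → FT j) →
                       (∀ y → IsLinear (G y)) → ∀ ys → IsLinear (λ t → concatMap (λ y → G y t) ys)
  IsLinear-concatMap G G-lin []       = IsLinear-[]
  IsLinear-concatMap G G-lin (y ∷ ys) = IsLinear-++ (G-lin y) (IsLinear-concatMap G G-lin ys)

  PointwiseW-refl : ∀ w → PointwiseW w w
  PointwiseW-refl []      = []
  PointwiseW-refl (_ ∷ w) = ≈ᴹ-refl ∷ PointwiseW-refl w

  PointwiseW-++ : ∀ {u u′ v v′} → PointwiseW u u′ → PointwiseW v v′ → PointwiseW (u ++ v) (u′ ++ v′)
  PointwiseW-++ []      q = q
  PointwiseW-++ (e ∷ p) q = e ∷ PointwiseW-++ p q

  word-letters : ∀ r {w w′} → PointwiseW w w′ → word r w ∼ word r w′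
  word-letters r {w} {w′} = ∼-letters r (w ∷ []) Fin.zero w′

  word-scal : ∀ {r s} w → r ≈ s → word r w ∼ word s w
  word-scal w = ∼-scal (w ∷ [])

  word-zero : ∀ w → word 0# w ∼ []
  word-zero w = ∼-zero (w ∷ [])

  word-add : ∀ r s w → word r w ++ word s w ∼ word (r + s) w
  word-add r s w = ∼-add r s (w ∷ [])

  record IsLinearInEachLetter (φ : Word → Word) : Set (c ⊔ m ⊔ ℓm) where
    field
      ψ             : V → V
      ψ-cong        : ∀ {x y} → x ≈ᴹ y → ψ x ≈ᴹ ψ y
      ψ-+           : ∀ x y → ψ (x +ᴹ y) ≈ᴹ ψ x +ᴹ ψ y
      ψ-*           : ∀ s x → ψ (s *ₗ x) ≈ᴹ s *ₗ ψ x
      prefix suffix : Word → Word → Word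
      split         : ∀ u z v → φ (u ++ z ∷ v) ≡ prefix u v ++ ψ z ∷ suffix u v
      φ-cong        : ∀ {w w′} → PointwiseW w w′ → PointwiseW (φ w) (φ w′)

    word-lin+ : ∀ r u x y v → word r (φ (u ++ (x +ᴹ y) ∷ v)) ∼ word r (φ (u ++ x ∷ v)) ++ word r (φ (u ++ y ∷ v))
    word-lin+ r u x y v = begin
      word r (φ (u ++ (x +ᴹ y) ∷ v))
        ≡⟨ cong (word r) (split u (x +ᴹ y) v) ⟩
      word r (prefix u v ++ ψ (x +ᴹ y) ∷ suffix u v)
        ≈⟨ word-letters r (PointwiseW-++ (PointwiseW-refl _) (ψ-+ x y ∷ PointwiseW-refl _)) ⟩
      word r (prefix u v ++ (ψ x +ᴹ ψ y) ∷ suffix u v)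
        ≈⟨ ∼-lin+ r ([] ∷ []) Fin.zero _ _ _ _ ⟩
      word r (prefix u v ++ ψ x ∷ suffix u v) ++ word r (prefix u v ++ ψ y ∷ suffix u v)
        ≡⟨ cong₂ (λ a b → word r a ++ word r b) (split u x v) (split u y v) ⟨
      word r (φ (u ++ x ∷ v)) ++ word r (φ (u ++ y ∷ v))
        ∎

    word-lin* : ∀ r u s x v → word r (φ (u ++ (s *ₗ x) ∷ v)) ∼ word (r * s) (φ (u ++ x ∷ v))
    word-lin* r u s x v = begin
      word r (φ (u ++ (s *ₗ x) ∷ v))
        ≡⟨ cong (word r) (split u (s *ₗ x) v) ⟩
      word r (prefix u v ++ ψ (s *ₗ x) ∷ suffix u v)
        ≈⟨ word-letters r (PointwiseW-++ (PointwiseW-refl _) (ψ-* s x ∷ PointwiseW-refl _)) ⟩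
      word r (prefix u v ++ (s *ₗ ψ x) ∷ suffix u v)
        ≈⟨ ∼-lin* r ([] ∷ []) Fin.zero _ _ _ _ ⟩
      word (r * s) (prefix u v ++ ψ x ∷ suffix u v)
        ≡⟨ cong (word (r * s)) (split u x v) ⟨
      word (r * s) (φ (u ++ x ∷ v))
        ∎
  open IsLinearInEachLetter

  IsLinearInEachLetter-≗ : ∀ {φ φ′} → (∀ w → φ w ≡ φ′ w) →
                           IsLinearInEachLetter φ → IsLinearInEachLetter φ′
  IsLinearInEachLetter-≗ φ≗φ′ lin = record
    { ψ = ψ lin ; ψ-cong = ψ-cong lin ; ψ-+ = ψ-+ lin ; ψ-* = ψ-* lin ; prefix = prefix lin ; suffix = suffix lin
    ; split  = λ u z v → trans (sym (φ≗φ′ _)) (split lin u z v)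
    ; φ-cong = λ {w} {w′} p → subst₂ PointwiseW (φ≗φ′ w) (φ≗φ′ w′) (φ-cong lin p) }

  infix-isLinearInEachLetter : ∀ P Q → IsLinearInEachLetter (λ w → P ++ w ++ Q)
  infix-isLinearInEachLetter P Q = record
    { ψ = λ x → x ; ψ-cong = λ e → e ; ψ-+ = λ _ _ → ≈ᴹ-refl ; ψ-* = λ _ _ → ≈ᴹ-refl
    ; prefix = λ u _ → P ++ u ; suffix = λ _ v → v ++ Q
    ; split  = λ u z v → trans (cong (P ++_) (Listₚ.++-assoc u (z ∷ v) Q)) (sym (Listₚ.++-assoc P u (z ∷ v ++ Q)))
    ; φ-cong = λ p → PointwiseW-++ (PointwiseW-refl P) (PointwiseW-++ p (PointwiseW-refl Q)) }

  prefix-isLinearInEachLetter : ∀ w → IsLinearInEachLetter (w ++_)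
  prefix-isLinearInEachLetter w =
    IsLinearInEachLetter-≗ (λ u → cong (w ++_) (Listₚ.++-identityʳ u)) (infix-isLinearInEachLetter w [])

  record IsKLinear (g : K → K) : Set (c ⊔ ℓ) where
    field
      g-cong : ∀ {r s} → r ≈ s → g r ≈ g s
      g-0#   : g 0# ≈ 0#
      g-+    : ∀ r s → g r + g s ≈ g (r + s)
      g-*    : ∀ r s → g (r * s) ≈ g r * s
  open IsKLinear

  id-isKLinear : IsKLinear (λ r → r)
  id-isKLinear = record { g-cong = λ e → e ; g-0# = ≈-refl ; g-+ = λ _ _ → ≈-refl ; g-* = λ _ _ → ≈-refl }

  *ˡ-isKLinear : ∀ s → IsKLinear (s *_)
  *ˡ-isKLinear s = record
    { g-cong = *-cong ≈-refl ; g-0# = zeroʳ s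
    ; g-+ = λ r t → ≈-sym (distribˡ s r t) ; g-* = λ r t → ≈-sym (*-assoc s r t) }

  *ʳ-isKLinear : ∀ s → IsKLinear (_* s)
  *ʳ-isKLinear s = record
    { g-cong = λ e → *-cong e ≈-refl ; g-0# = zeroˡ s ; g-+ = λ r t → ≈-sym (distribʳ s r t)
    ; g-* = λ r t → ≈-trans (*-assoc r t s) (≈-trans (*-cong ≈-refl (*-comm t s)) (≈-sym (*-assoc r s t))) }

  onTerm : (K → Word → A) → K × Vec Word 1 → A
  onTerm f (r , ws) = f r (Vec.head ws)

  onTerm₂ : (K → Word → Word → A) → K × Vec Word 2 → A
  onTerm₂ f (r , ws) = f r (Vec.head ws) (Vec.head (Vec.tail ws))

  wordMap₁ : (K → K) → (Word → Word) → K × Vec Word 1 → T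
  wordMap₁ g φ = onTerm λ r w → word (g r) (φ w)

  wordMap₁-linear : ∀ {g φ} → IsKLinear g → IsLinearInEachLetter φ → IsLinear (wordMap₁ g φ)
  wordMap₁-linear {g} G Φ = record
    { resp-zero    = λ { (_ ∷ []) → ∼-trans (word-scal _ (g-0# G)) (word-zero _) }
    ; resp-add     = λ { r s (_ ∷ []) → ∼-trans (word-add _ _ _) (word-scal _ (g-+ G r s)) }
    ; resp-scal    = λ { (_ ∷ []) e → word-scal _ (g-cong G e) }
    ; resp-letters = λ { r (_ ∷ []) Fin.zero _ p → word-letters _ (φ-cong Φ p) }
    ; resp-lin+    = λ { r (_ ∷ []) Fin.zero u x y v → word-lin+ Φ (g r) u x y v }
    ; resp-lin*    = λ { r (_ ∷ []) Fin.zero u s x v →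
                           ∼-trans (word-lin* Φ (g r) u s x v) (word-scal _ (≈-sym (g-* G r s))) } }

  wordMap₂ : (K → K) → (Word → Word → Word) → K × Vec Word 2 → T
  wordMap₂ g φ = onTerm₂ λ r a b → word (g r) (φ a b)

  wordMap₂-linear : ∀ {g φ} → IsKLinear g → (∀ b → IsLinearInEachLetter (λ a → φ a b)) →
                    (∀ a → IsLinearInEachLetter (φ a)) → IsLinear (wordMap₂ g φ)
  wordMap₂-linear {g} G Φˡ Φʳ = record
    { resp-zero    = λ { (_ ∷ _ ∷ []) → ∼-trans (word-scal _ (g-0# G)) (word-zero _) }
    ; resp-add     = λ { r s (_ ∷ _ ∷ []) → ∼-trans (word-add _ _ _) (word-scal _ (g-+ G r s)) }
    ; resp-scal    = λ { (_ ∷ _ ∷ []) e → word-scal _ (g-cong G e) }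
    ; resp-letters = λ { r (a ∷ b ∷ []) Fin.zero            _ p → word-letters _ (φ-cong (Φˡ b) p)
                       ; r (a ∷ b ∷ []) (Fin.suc Fin.zero) _ p → word-letters _ (φ-cong (Φʳ a) p) }
    ; resp-lin+    = λ { r (a ∷ b ∷ []) Fin.zero            u x y v → word-lin+ (Φˡ b) (g r) u x y v
                       ; r (a ∷ b ∷ []) (Fin.suc Fin.zero) u x y v → word-lin+ (Φʳ a) (g r) u x y v }
    ; resp-lin*    = λ { r (a ∷ b ∷ []) Fin.zero u s x v →
                           ∼-trans (word-lin* (Φˡ b) (g r) u s x v) (word-scal _ (≈-sym (g-* G r s)))
                       ; r (a ∷ b ∷ []) (Fin.suc Fin.zero) u s x v →
                           ∼-trans (word-lin* (Φʳ a) (g r) u s x v) (word-scal _ (≈-sym (g-* G r s))) } }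

  ∑ : ∀ {j} → T → (K → Word → FT j) → FT j
  ∑ a f = concatMap (onTerm f) a

  syntax ∑ a (λ r w → e) = ∑[ r · w ∈ a ] e

  ∑-cong : ∀ {j} a {f g : K → Word → FT j} → (∀ r w → f r w ∼ g r w) → ∑ a f ∼ ∑ a g
  ∑-cong a f∼g = concatMap-∼ (λ _ → f∼g _ _) a

  ∑-≗ : ∀ {j} a {f g : K → Word → FT j} → (∀ r w → f r w ≡ g r w) → ∑ a f ≡ ∑ a g
  ∑-≗ a f≡g = Listₚ.concatMap-cong (λ _ → f≡g _ _) a

  ∑-cong-homogeneous : ∀ {j d} a {f g : K → Word → FT j} → Homogeneous d a →
                       (∀ r w → length w ≡ d → f r w ∼ g r w) → ∑ a f ∼ ∑ a g
  ∑-cong-homogeneous []                 []          _   = ∼-refl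
  ∑-cong-homogeneous ((r , w ∷ []) ∷ a) (|w| ∷ hom) f∼g = ∼-++ (f∼g r w |w|) (∑-cong-homogeneous a hom f∼g)

  ∑-comm : ∀ {j} a b (F : K → Word → K → Word → FT j) →
           ∑[ r · w ∈ a ] ∑[ s · u ∈ b ] F r w s u ∼ ∑[ s · u ∈ b ] ∑[ r · w ∈ a ] F r w s u
  ∑-comm a b F = concatMap-comm (λ x y → onTerm (λ r w → onTerm (F r w) y) x) a b

  ∑-concatMap-comm : ∀ {j} a (ys : List B) (F : K → Word → B → FT j) →
                     ∑[ r · w ∈ a ] concatMap (F r w) ys ∼ concatMap (λ y → ∑[ r · w ∈ a ] F r w y) ys
  ∑-concatMap-comm a ys F = concatMap-comm (λ x y → onTerm (λ r w → F r w y) x) a ys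

  concatMap-∑ : ∀ {j} (G : K × Vec Word 1 → FT j) a (f : K → Word → T) →
                concatMap G (∑ a f) ≡ ∑[ r · w ∈ a ] concatMap G (f r w)
  concatMap-∑ G a f = concatMap-concatMap G (onTerm f) a

  ∑-word : ∀ {j} r w (f : K → Word → FT j) → ∑ (word r w) f ≡ f r w
  ∑-word r w f = Listₚ.++-identityʳ (f r w)

  ∑-∑-word : ∀ {j} a (g : K → Word → K) (φ : K → Word → Word) (f : K → Word → FT j) →
             ∑ (∑[ r · w ∈ a ] word (g r w) (φ r w)) f ≡ ∑[ r · w ∈ a ] f (g r w) (φ r w)
  ∑-∑-word a g φ f =
    trans (concatMap-∑ (onTerm f) a (λ r w → word (g r w) (φ r w))) (∑-≗ a λ r w → ∑-word (g r w) (φ r w) f)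

  ∑-word-id : ∀ a → ∑ a word ≡ a
  ∑-word-id []                 = refl
  ∑-word-id ((r , w ∷ []) ∷ a) = cong ((r , w ∷ []) ∷_) (∑-word-id a)

  map-as-∑ : (f : K × Vec Word 1 → K × Vec Word 1) (g : K → Word → T) →
             (∀ r w → f (r , w ∷ []) ∷ [] ≡ g r w) → ∀ a → map f a ≡ ∑ a g
  map-as-∑ f g f≡g []                 = refl
  map-as-∑ f g f≡g ((r , w ∷ []) ∷ a) = cong₂ _++_ (f≡g r w) (map-as-∑ f g f≡g a)

  *T-∑ : ∀ a b → a *T b ≡ ∑[ r · w ∈ a ] ∑[ s · u ∈ b ] word (r * s) (w ++ u)
  *T-∑ a b = Listₚ.concatMap-cong (λ { (r , w ∷ []) → map-as-∑ _ _ (λ _ _ → refl) b }) a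

  -T-∑ : ∀ a → -T a ≡ ∑[ r · w ∈ a ] word (- r) w
  -T-∑ = map-as-∑ _ _ (λ _ _ → refl)

  ∑-*T : ∀ {j} a b (f : K → Word → FT j) → ∑ (a *T b) f ≡ ∑[ r · w ∈ a ] ∑[ s · u ∈ b ] f (r * s) (w ++ u)
  ∑-*T a b f =
    trans (cong (λ x → ∑ x f) (*T-∑ a b))
          (trans (concatMap-∑ (onTerm f) a (λ r w → ∑[ s · u ∈ b ] word (r * s) (w ++ u)))
                 (∑-≗ a λ r w → ∑-∑-word b (λ s _ → r * s) (λ _ u → w ++ u) f))

  *T-congʳ : ∀ {a a′} b → a ∼ a′ → a *T b ∼ a′ *T b
  *T-congʳ {a} {a′} b a∼a′ = begin
    a *T b         ≡⟨ *T-∑ a b ⟩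
    concatMap F a  ≈⟨ concatMap-resp F-linear a∼a′ ⟩
    concatMap F a′ ≡⟨ *T-∑ a′ b ⟨
    a′ *T b        ∎
    where
      F : K × Vec Word 1 → T
      F t = ∑[ s · u ∈ b ] wordMap₁ (_* s) (_++ u) t
      F-linear : IsLinear F
      F-linear = IsLinear-concatMap _ (λ _ → wordMap₁-linear (*ʳ-isKLinear _) (infix-isLinearInEachLetter [] _)) b

  *T-congˡ : ∀ a {b b′} → b ∼ b′ → a *T b ∼ a *T b′
  *T-congˡ a {b} {b′} b∼b′ = begin
    a *T b                                                ≡⟨ *T-∑ a b ⟩
    ∑[ r · w ∈ a ] concatMap (wordMap₁ (r *_) (w ++_)) b
      ≈⟨ ∑-cong a (λ r w → concatMap-resp (F-linear r w) b∼b′) ⟩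
    ∑[ r · w ∈ a ] concatMap (wordMap₁ (r *_) (w ++_)) b′ ≡⟨ *T-∑ a b′ ⟨
    a *T b′                                               ∎
    where
      F-linear : ∀ r w → IsLinear (wordMap₁ (r *_) (w ++_))
      F-linear r w = wordMap₁-linear (*ˡ-isKLinear r) (prefix-isLinearInEachLetter w)

  +T-inverseʳ : ∀ a → a +T (-T a) ∼ 0T
  +T-inverseʳ a = begin
    a ++ -T a                                 ≡⟨ cong₂ _++_ (sym (∑-word-id a)) (-T-∑ a) ⟩
    ∑ a word ++ ∑[ r · w ∈ a ] word (- r) w   ≈⟨ concatMap-++-distrib _ _ a ⟨
    ∑[ r · w ∈ a ] (word r w ++ word (- r) w) ≈⟨ ∑-cong a cancel ⟩
    ∑[ r · w ∈ a ] []                         ≡⟨ concatMap-const-[] a ⟩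
    []                                        ∎
    where
      cancel : ∀ r w → word r w ++ word (- r) w ∼ []
      cancel r w = ∼-trans (word-add r (- r) w) (∼-trans (word-scal w (-‿inverseʳ r)) (word-zero w))

  ∑-All : ∀ {p q} {P : K × Vec Word 1 → Set p} {Q : K × Vec Word 1 → Set q} a (f : K → Word → T) →
          All P a → (∀ r w → P (r , w ∷ []) → All Q (f r w)) → All Q (∑ a f)
  ∑-All []                 f []        Qf = []
  ∑-All ((r , w ∷ []) ∷ a) f (Pt ∷ Pa) Qf = Allₚ.++⁺ (Qf r w Pt) (∑-All a f Pa Qf)

  *T-homogeneous : ∀ {d e a b} → Homogeneous d a → Homogeneous e b → Homogeneous (d ℕ.+ e) (a *T b)
  *T-homogeneous {d} {e} {a} {b} hom-a hom-b = subst (Homogeneous (d ℕ.+ e)) (sym (*T-∑ a b))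
    (∑-All a (λ r w → ∑[ s · u ∈ b ] word (r * s) (w ++ u)) hom-a λ r w |w| →
       ∑-All b (λ s u → word (r * s) (w ++ u)) hom-b λ s u |u| →
         trans (Listₚ.length-++ w) (cong₂ ℕ._+_ |w| |u|) ∷ [])

  foldl-*T-homogeneous : ∀ {d a} (rest : List (T × ℕ)) → Homogeneous d a →
                         All (λ q → Homogeneous (proj₂ q) (proj₁ q)) rest →
                         Homogeneous (d ℕ.+ foldr ℕ._+_ 0 (map proj₂ rest)) (foldl _*T_ a (map proj₁ rest))
  foldl-*T-homogeneous {d} {a} [] hom-a [] = subst (λ e → Homogeneous e a) (sym (ℕₚ.+-identityʳ d)) hom-a
  foldl-*T-homogeneous {d} {a} ((p , e) ∷ rest) hom-a (hom-p ∷ homs) =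
    subst (λ e′ → Homogeneous e′ (foldl _*T_ (a *T p) (map proj₁ rest))) (ℕₚ.+-assoc d e _)
      (foldl-*T-homogeneous rest (*T-homogeneous hom-a hom-p) homs)

module Conjugation {c ℓ m ℓm : Level} (R : CommutativeRing c ℓ) (M : Module R m ℓm)
  (bar : Module.Carrierᴹ M → Module.Carrierᴹ M) (bar-involution : IsLinearInvolution R M bar) where

  open CommutativeRing R using (_*_; *-comm) renaming (Carrier to K)
  open IsLinearInvolution bar-involution
  open TensorAlgebra R M
  open WithInvolution bar
  open FormalSums R M

  barW : Word → Word
  barW w = List.reverse (map bar w)

  barW-++ : ∀ u v → barW (u ++ v) ≡ barW v ++ barW u
  barW-++ u v = trans (cong List.reverse (Listₚ.map-++ bar u v)) (Listₚ.reverse-++ (map bar u) (map bar v))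

  barW-∷ : ∀ z v → barW (z ∷ v) ≡ barW v ++ bar z ∷ []
  barW-∷ z v = Listₚ.unfold-reverse (bar z) (map bar v)

  barW-around : ∀ u z v → barW (u ++ z ∷ v) ≡ barW v ++ bar z ∷ barW u
  barW-around u z v =
    trans (barW-++ u (z ∷ v)) (trans (cong (_++ barW u) (barW-∷ z v)) (Listₚ.++-assoc (barW v) _ (barW u)))

  PointwiseW-reverse : ∀ {u u′} → PointwiseW u u′ → PointwiseW (List.reverse u) (List.reverse u′)
  PointwiseW-reverse [] = []
  PointwiseW-reverse {x ∷ u} {y ∷ u′} (e ∷ p)
    rewrite Listₚ.unfold-reverse x u | Listₚ.unfold-reverse y u′ = PointwiseW-++ (PointwiseW-reverse p) (e ∷ [])

  PointwiseW-barW : ∀ {w w′} → PointwiseW w w′ → PointwiseW (barW w) (barW w′)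
  PointwiseW-barW = PointwiseW-reverse ∘ map-bar
    where
      map-bar : ∀ {w w′} → PointwiseW w w′ → PointwiseW (map bar w) (map bar w′)
      map-bar []      = []
      map-bar (e ∷ p) = bar-cong e ∷ map-bar p

  barW-involutive : ∀ w → PointwiseW (barW (barW w)) w
  barW-involutive w
    rewrite Listₚ.reverse-map bar (map bar w) | Listₚ.reverse-involutive (map bar (map bar w)) = bar-bar* w
    where
      bar-bar* : ∀ w → PointwiseW (map bar (map bar w)) w
      bar-bar* []      = []
      bar-bar* (x ∷ w) = bar-bar x ∷ bar-bar* w

  barW-isLinearInEachLetter : ∀ P Q → IsLinearInEachLetter (λ w → P ++ barW w ++ Q)
  barW-isLinearInEachLetter P Q = record
    { ψ = bar ; ψ-cong = bar-cong ; ψ-+ = bar-+ ; ψ-* = bar-*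
    ; prefix = λ _ v → P ++ barW v ; suffix = λ u _ → barW u ++ Q
    ; split  = λ u z v → trans (cong (λ x → P ++ x ++ Q) (barW-around u z v))
                           (trans (cong (P ++_) (Listₚ.++-assoc (barW v) (bar z ∷ barW u) Q))
                                  (sym (Listₚ.++-assoc P (barW v) _)))
    ; φ-cong = λ p → PointwiseW-++ (PointwiseW-refl P) (PointwiseW-++ (PointwiseW-barW p) (PointwiseW-refl Q)) }

  barT-∑ : ∀ a → barT a ≡ ∑[ r · w ∈ a ] word r (barW w)
  barT-∑ = map-as-∑ _ _ (λ _ _ → refl)

  ∑-barT : ∀ {j} a (f : K → Word → FT j) → ∑ (barT a) f ≡ ∑[ r · w ∈ a ] f r (barW w)
  ∑-barT a f = trans (cong (λ x → ∑ x f) (barT-∑ a)) (∑-∑-word a (λ r _ → r) (λ _ w → barW w) f)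

  barT-cong : ∀ {a b} → a ∼ b → barT a ∼ barT b
  barT-cong {a} {b} a∼b = begin
    barT a                                ≡⟨ barT-∑ a ⟩
    concatMap (wordMap₁ (λ r → r) barW) a ≈⟨ concatMap-resp (wordMap₁-linear id-isKLinear barW-linear) a∼b ⟩
    concatMap (wordMap₁ (λ r → r) barW) b ≡⟨ barT-∑ b ⟨
    barT b                                ∎
    where
      barW-linear : IsLinearInEachLetter barW
      barW-linear = IsLinearInEachLetter-≗ (Listₚ.++-identityʳ ∘ barW) (barW-isLinearInEachLetter [] [])

  ∇-cong : ∀ {a b} → a ∼ b → ∇ a ∼ ∇ b
  ∇-cong a∼b = ∼-++ a∼b (barT-cong a∼b)

  barT-*T : ∀ a b → barT (a *T b) ∼ barT b *T barT a
  barT-*T a b = begin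
    barT (a *T b)
      ≡⟨ trans (barT-∑ (a *T b)) (∑-*T a b (λ r w → word r (barW w))) ⟩
    ∑[ r · w ∈ a ] ∑[ s · u ∈ b ] word (r * s) (barW (w ++ u))
      ≈⟨ ∑-comm a b (λ r w s u → word (r * s) (barW (w ++ u))) ⟩
    ∑[ s · u ∈ b ] ∑[ r · w ∈ a ] word (r * s) (barW (w ++ u))
      ≈⟨ ∑-cong b (λ s u → ∑-cong a λ r w →
           ∼-trans (word-scal _ (*-comm r s)) (≡⇒∼ (cong (word (s * r)) (barW-++ w u)))) ⟩
    ∑[ s · u ∈ b ] ∑[ r · w ∈ a ] word (s * r) (barW u ++ barW w)
      ≡⟨ trans (∑-barT b (λ s u → ∑[ r · w ∈ barT a ] word (s * r) (u ++ w)))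
               (∑-≗ b λ s u → ∑-barT a (λ r w → word (s * r) (barW u ++ w))) ⟨
    ∑[ s · u ∈ barT b ] ∑[ r · w ∈ barT a ] word (s * r) (u ++ w)
      ≡⟨ *T-∑ (barT b) (barT a) ⟨
    barT b *T barT a
      ∎

  barT-involutive : ∀ a → barT (barT a) ∼ a
  barT-involutive a = begin
    barT (barT a)                         ≡⟨ trans (barT-∑ (barT a)) (∑-barT a (λ r w → word r (barW w))) ⟩
    ∑[ r · w ∈ a ] word r (barW (barW w)) ≈⟨ ∑-cong a (λ r w → word-letters r (barW-involutive w)) ⟩
    ∑ a word                              ≡⟨ ∑-word-id a ⟩
    a                                     ∎

  barT-∇ : ∀ a → barT (∇ a) ∼ ∇ a
  barT-∇ a = begin
    barT (a ++ barT a)      ≡⟨ Listₚ.map-++ _ a (barT a) ⟩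
    barT a ++ barT (barT a) ≈⟨ ++-congˡ (barT a) (barT-involutive a) ⟩
    barT a ++ a             ≈⟨ ∼-comm (barT a) a ⟩
    a ++ barT a             ∎

module Convolution {c ℓ m ℓm : Level} (R : CommutativeRing c ℓ) (M : Module R m ℓm)
  (bar : Module.Carrierᴹ M → Module.Carrierᴹ M) (bar-involution : IsLinearInvolution R M bar) where

  open CommutativeRing R using (_*_; 1#; *-comm; *-identityʳ) renaming (Carrier to K; sym to ≈-sym)
  open Module M using () renaming (Carrierᴹ to V)
  open TensorAlgebra R M
  open WithInvolution bar
  open FormalSums R M
  open Conjugation R M bar bar-involution

  insert : V → Word × Word → List (Word × Word)
  insert z (x , y) = (z ∷ x , y) ∷ (x , z ∷ y) ∷ []

  splittings : Word → List (Word × Word)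
  splittings []      = ([] , []) ∷ []
  splittings (z ∷ w) = concatMap (insert z) (splittings w)

  Δw≡splittings : ∀ w → Δw w ≡ map (λ (x , y) → (1# , x ∷ y ∷ [])) (splittings w)
  Δw≡splittings []      = refl
  Δw≡splittings (z ∷ w) =
    trans (cong (concatMap _) (Δw≡splittings w))
          (trans (Listₚ.concatMap-map _ _ (splittings w)) (sym (Listₚ.map-concatMap _ (insert z) (splittings w))))

  concatMap-insert : ∀ {j} (f : Word → Word → FT j) z xs →
                     concatMap (uncurry f) (concatMap (insert z) xs)
                       ≡ concatMap (uncurry λ x y → f (z ∷ x) y ++ f x (z ∷ y)) xs
  concatMap-insert f z xs =
    trans (concatMap-concatMap (uncurry f) (insert z) xs)
          (Listₚ.concatMap-cong (λ (x , y) → cong (f (z ∷ x) y ++_) (Listₚ.++-identityʳ (f x (z ∷ y)))) xs)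

  splittings-++ : ∀ {j} (f : Word → Word → FT j) w u →
                  concatMap (uncurry f) (splittings (w ++ u))
                    ∼ concatMap (uncurry λ x₁ y₁ →
                                   concatMap (uncurry λ x₂ y₂ → f (x₁ ++ x₂) (y₁ ++ y₂)) (splittings u))
                                (splittings w)
  splittings-++ f []      u = ≡⇒∼ (sym (Listₚ.++-identityʳ _))
  splittings-++ f (z ∷ w) u = begin
    concatMap (uncurry f) (concatMap (insert z) (splittings (w ++ u)))
      ≡⟨ concatMap-insert f z (splittings (w ++ u)) ⟩
    concatMap (uncurry g) (splittings (w ++ u))
      ≈⟨ splittings-++ g w u ⟩
    concatMap (uncurry λ x₁ y₁ → concatMap (uncurry λ x₂ y₂ → g (x₁ ++ x₂) (y₁ ++ y₂)) (splittings u))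
              (splittings w)
      ≈⟨ concatMap-∼ (λ _ → concatMap-++-distrib _ _ (splittings u)) (splittings w) ⟩
    concatMap (uncurry λ x y → h (z ∷ x) y ++ h x (z ∷ y)) (splittings w)
      ≡⟨ concatMap-insert h z (splittings w) ⟨
    concatMap (uncurry h) (concatMap (insert z) (splittings w))
      ∎
    where
      g h : Word → Word → FT _
      g x y = f (z ∷ x) y ++ f x (z ∷ y)
      h x₁ y₁ = concatMap (uncurry λ x₂ y₂ → f (x₁ ++ x₂) (y₁ ++ y₂)) (splittings u)

  concatMap-Δ : ∀ {j} (L : K × Vec Word 2 → FT j) p →
                concatMap L (Δ p)
                  ≡ ∑[ s · u ∈ p ] concatMap (uncurry λ x y → L (s * 1# , x ∷ y ∷ [])) (splittings u)
  concatMap-Δ L p = trans (concatMap-concatMap L _ p) (Listₚ.concatMap-cong (λ { (s , u ∷ []) →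
    trans (Listₚ.concatMap-map L _ (Δw u))
          (trans (cong (concatMap _) (Δw≡splittings u)) (Listₚ.concatMap-map _ _ (splittings u))) }) p)

  concatMap-prim-rhs : ∀ {j} (L : K × Vec Word 2 → FT j) p →
                       concatMap L (prim-rhs p)
                         ≡ ∑[ s · u ∈ p ] L (s , u ∷ [] ∷ []) ++ ∑[ s · u ∈ p ] L (s , [] ∷ u ∷ [])
  concatMap-prim-rhs L p = trans (Listₚ.concatMap-++ L (map _ p) (map _ p)) (cong₂ _++_
    (trans (Listₚ.concatMap-map L _ p) (Listₚ.concatMap-cong (λ { (_ , _ ∷ []) → refl }) p))
    (trans (Listₚ.concatMap-map L _ p) (Listₚ.concatMap-cong (λ { (_ , _ ∷ []) → refl }) p)))

  -- bar ⋆ id = μ ∘ (bar ⊗ id) ∘ Δ, the convolution of bar and the identity.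
  bar⋆idʷ : K → Word → T
  bar⋆idʷ r w = concatMap (uncurry λ x y → word r (barW x ++ y)) (splittings w)

  bar⋆id : T → T
  bar⋆id a = ∑ a bar⋆idʷ

  ∑-bar⋆id : ∀ {j} a (h : K → Word → FT j) →
             ∑ (bar⋆id a) h ≡ ∑[ r · w ∈ a ] concatMap (uncurry λ x y → h r (barW x ++ y)) (splittings w)
  ∑-bar⋆id a h = trans (concatMap-∑ (onTerm h) a bar⋆idʷ) (∑-≗ a λ r w →
    trans (concatMap-concatMap (onTerm h) _ (splittings w))
          (Listₚ.concatMap-cong (λ (x , y) → ∑-word r (barW x ++ y) h) (splittings w)))

  bar⋆idʷ-++ : ∀ r w u →
               bar⋆idʷ r (w ++ u)
                 ∼ concatMap (uncurry λ x₁ y₁ →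
                                concatMap (uncurry λ x₂ y₂ → word r (barW x₂ ++ (barW x₁ ++ y₁) ++ y₂))
                                          (splittings u))
                             (splittings w)
  bar⋆idʷ-++ r w u = ∼-trans (splittings-++ (λ x y → word r (barW x ++ y)) w u)
    (≡⇒∼ (Listₚ.concatMap-cong (λ (x₁ , y₁) → Listₚ.concatMap-cong (λ (x₂ , y₂) →
      cong (word r) (regroup x₁ x₂ y₁ y₂)) (splittings u)) (splittings w)))
    where
      regroup : ∀ x₁ x₂ y₁ y₂ → barW (x₁ ++ x₂) ++ y₁ ++ y₂ ≡ barW x₂ ++ (barW x₁ ++ y₁) ++ y₂
      regroup x₁ x₂ y₁ y₂ =
        trans (cong (_++ y₁ ++ y₂) (barW-++ x₁ x₂))
              (trans (Listₚ.++-assoc (barW x₂) (barW x₁) (y₁ ++ y₂))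
                     (cong (barW x₂ ++_) (sym (Listₚ.++-assoc (barW x₁) y₁ y₂))))

  bar⋆id-primitive : ∀ p → IsLiePoly p → bar⋆id p ∼ ∇ p
  bar⋆id-primitive p lie = begin
    bar⋆id p
      ≈⟨ ∑-cong p (λ s u → concatMap-∼ (λ _ → word-scal _ (≈-sym (*-identityʳ s))) (splittings u)) ⟩
    ∑[ s · u ∈ p ] concatMap (uncurry λ x y → L (s * 1# , x ∷ y ∷ [])) (splittings u)
      ≡⟨ concatMap-Δ L p ⟨
    concatMap L (Δ p)
      ≈⟨ concatMap-resp L-linear lie ⟩
    concatMap L (prim-rhs p)
      ≡⟨ concatMap-prim-rhs L p ⟩
    ∑[ s · u ∈ p ] word s (barW u ++ []) ++ ∑ p word
      ≡⟨ cong₂ _++_ (trans (∑-≗ p λ s u → cong (word s) (Listₚ.++-identityʳ (barW u))) (sym (barT-∑ p)))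
                    (∑-word-id p) ⟩
    barT p ++ p
      ≈⟨ ∼-comm (barT p) p ⟩
    ∇ p
      ∎
    where
      L : K × Vec Word 2 → T
      L = wordMap₂ (λ r → r) (λ x y → barW x ++ y)
      L-linear : IsLinear L
      L-linear = wordMap₂-linear id-isKLinear (barW-isLinearInEachLetter []) (prefix-isLinearInEachLetter ∘ barW)

  sandwich : T → K × Vec Word 2 → T
  sandwich g = onTerm₂ λ s x y → ∑[ r · v ∈ g ] word (r * s) (barW x ++ v ++ y)

  sandwich-linear : ∀ g → IsLinear (sandwich g)
  sandwich-linear = IsLinear-concatMap _ λ (r , vs) →
    wordMap₂-linear (*ˡ-isKLinear r) (λ y → barW-isLinearInEachLetter [] (Vec.head vs ++ y)) λ x →
      IsLinearInEachLetter-≗ (Listₚ.++-assoc (barW x) (Vec.head vs))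
                             (prefix-isLinearInEachLetter (barW x ++ Vec.head vs))

  concatMap-sandwich-Δ : ∀ g p →
                         concatMap (sandwich g) (Δ p)
                           ∼ ∑[ s · u ∈ p ] concatMap (uncurry λ x y →
                                                          ∑[ r · v ∈ g ] word (r * s) (barW x ++ v ++ y))
                                                        (splittings u)
  concatMap-sandwich-Δ g p = begin
    concatMap (sandwich g) (Δ p)
      ≡⟨ concatMap-Δ (sandwich g) p ⟩
    ∑[ s · u ∈ p ] concatMap (uncurry λ x y → sandwich g (s * 1# , x ∷ y ∷ [])) (splittings u)
      ≈⟨ ∑-cong p (λ s u → concatMap-∼ (λ (x , y) →
           IsLinear.resp-scal (sandwich-linear g) (x ∷ y ∷ []) (*-identityʳ s)) (splittings u)) ⟩
    ∑[ s · u ∈ p ] concatMap (uncurry λ x y → sandwich g (s , x ∷ y ∷ [])) (splittings u)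
      ∎

  sandwich-prim-rhs : ∀ g p → concatMap (sandwich g) (prim-rhs p) ∼ barT p *T g ++ g *T p
  sandwich-prim-rhs g p = begin
    concatMap (sandwich g) (prim-rhs p)
      ≡⟨ concatMap-prim-rhs (sandwich g) p ⟩
    ∑[ s · u ∈ p ] ∑[ r · v ∈ g ] word (r * s) (barW u ++ v ++ [])
      ++ ∑[ s · u ∈ p ] ∑[ r · v ∈ g ] word (r * s) (v ++ u)
      ≈⟨ ∼-++ (∑-cong p λ s u → ∑-cong g λ r v → ∼-trans (word-scal _ (*-comm r s))
                 (≡⇒∼ (cong (λ v′ → word (s * r) (barW u ++ v′)) (Listₚ.++-identityʳ v))))
              (∑-comm p g (λ s u r v → word (r * s) (v ++ u))) ⟩
    ∑[ s · u ∈ p ] ∑[ r · v ∈ g ] word (s * r) (barW u ++ v)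
      ++ ∑[ r · v ∈ g ] ∑[ s · u ∈ p ] word (r * s) (v ++ u)
      ≡⟨ cong₂ _++_ (trans (*T-∑ (barT p) g) (∑-barT p λ s u → ∑[ r · v ∈ g ] word (s * r) (u ++ v)))
                    (*T-∑ g p) ⟨
    barT p *T g ++ g *T p
      ∎

  bar⋆id-*T : ∀ a p → bar⋆id (a *T p) ∼ concatMap (sandwich (bar⋆id a)) (Δ p)
  bar⋆id-*T a p = begin
    bar⋆id (a *T p)
      ≡⟨ ∑-*T a p bar⋆idʷ ⟩
    ∑[ r · w ∈ a ] ∑[ s · u ∈ p ] bar⋆idʷ (r * s) (w ++ u)
      ≈⟨ ∑-cong a (λ r w → ∑-cong p (λ s u → bar⋆idʷ-++ (r * s) w u)) ⟩
    ∑[ r · w ∈ a ] ∑[ s · u ∈ p ] Q r w s u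
      ≈⟨ ∑-comm a p Q ⟩
    ∑[ s · u ∈ p ] ∑[ r · w ∈ a ] Q r w s u
      ≈⟨ ∑-cong p (λ s u → ∼-trans
           (∑-cong a λ r w → concatMap-comm (λ (x₁ , y₁) → W r s x₁ y₁) (splittings w) (splittings u))
           (∑-concatMap-comm a (splittings u) λ r w x₂y₂ →
              concatMap (λ (x₁ , y₁) → W r s x₁ y₁ x₂y₂) (splittings w))) ⟩
    ∑[ s · u ∈ p ] concatMap (λ x₂y₂ → ∑[ r · w ∈ a ]
                               concatMap (λ (x₁ , y₁) → W r s x₁ y₁ x₂y₂) (splittings w))
                             (splittings u)
      ≡⟨ ∑-≗ p (λ s u → Listₚ.concatMap-cong (λ (x₂ , y₂) →
           sym (∑-bar⋆id a λ r v → word (r * s) (barW x₂ ++ v ++ y₂))) (splittings u)) ⟩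
    ∑[ s · u ∈ p ] concatMap (uncurry λ x y → ∑[ r · v ∈ bar⋆id a ] word (r * s) (barW x ++ v ++ y))
                             (splittings u)
      ≈⟨ concatMap-sandwich-Δ (bar⋆id a) p ⟨
    concatMap (sandwich (bar⋆id a)) (Δ p)
      ∎
    where
      W : K → K → Word → Word → Word × Word → T
      W r s x₁ y₁ (x₂ , y₂) = word (r * s) (barW x₂ ++ (barW x₁ ++ y₁) ++ y₂)
      Q : K → Word → K → Word → T
      Q r w s u = concatMap (λ (x₁ , y₁) → concatMap (W r s x₁ y₁) (splittings u)) (splittings w)

  bar⋆id-*T-primitive : ∀ a p → IsLiePoly p → bar⋆id (a *T p) ∼ bar⋆id a *T p ++ barT p *T bar⋆id a
  bar⋆id-*T-primitive a p lie = begin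
    bar⋆id (a *T p)                              ≈⟨ bar⋆id-*T a p ⟩
    concatMap (sandwich (bar⋆id a)) (Δ p)        ≈⟨ concatMap-resp (sandwich-linear (bar⋆id a)) lie ⟩
    concatMap (sandwich (bar⋆id a)) (prim-rhs p) ≈⟨ sandwich-prim-rhs (bar⋆id a) p ⟩
    barT p *T bar⋆id a ++ bar⋆id a *T p          ≈⟨ ∼-comm (barT p *T bar⋆id a) (bar⋆id a *T p) ⟩
    bar⋆id a *T p ++ barT p *T bar⋆id a          ∎

  ∇-step : T → T → T
  ∇-step acc p = ∇ (acc *T p)

  -- Self-conjugacy of N turns p̄ · N into the conjugate of N · p, so each step produces ∇ (N · p).
  bar⋆id-foldl : ∀ {a N} ps → All IsLiePoly ps → bar⋆id a ∼ N → barT N ∼ N →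
                 bar⋆id (foldl _*T_ a ps) ∼ foldl ∇-step N ps
  bar⋆id-foldl []       []           a∼N _   = a∼N
  bar⋆id-foldl {a} {N} (p ∷ ps) (lie ∷ lies) a∼N N̄∼N = bar⋆id-foldl ps lies step (barT-∇ (N *T p))
    where
      step : bar⋆id (a *T p) ∼ ∇ (N *T p)
      step = begin
        bar⋆id (a *T p)
          ≈⟨ bar⋆id-*T-primitive a p lie ⟩
        bar⋆id a *T p ++ barT p *T bar⋆id a
          ≈⟨ ∼-++ (*T-congʳ p a∼N) (*T-congˡ (barT p) (∼-trans a∼N (∼-sym N̄∼N))) ⟩
        N *T p ++ barT p *T barT N
          ≈⟨ ++-congˡ (N *T p) (∼-sym (barT-*T N p)) ⟩
        N *T p ++ barT (N *T p)
          ∎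

  foldl-∇-step-cong : ∀ ps {x y} → x ∼ y → foldl ∇-step x ps ∼ foldl ∇-step y ps
  foldl-∇-step-cong []       x∼y = x∼y
  foldl-∇-step-cong (p ∷ ps) x∼y = foldl-∇-step-cong ps (∇-cong (*T-congʳ p x∼y))

  foldl-∇-step-0T : ∀ ps → foldl ∇-step 0T ps ≡ 0T
  foldl-∇-step-0T []       = refl
  foldl-∇-step-0T (_ ∷ ps) = foldl-∇-step-0T ps

module ActionOfX0 {c ℓ m ℓm : Level} (R : CommutativeRing c ℓ) (M : Module R m ℓm)
  (bar : Module.Carrierᴹ M → Module.Carrierᴹ M) (bar-involution : IsLinearInvolution R M bar) where

  open CommutativeRing R using (_*_; 1#; *-identityʳ) renaming (Carrier to K)
  open Module M using () renaming (Carrierᴹ to V)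
  open TensorAlgebra R M
  open WithInvolution bar
  open FormalSums R M
  open Conjugation R M bar bar-involution
  open Convolution R M bar bar-involution
  open SignedPermutations

  signedLetter : (w : Word) → SVal (length w) → V
  signedLetter w (true  , j) = List.lookup w j
  signedLetter w (false , j) = bar (List.lookup w j)

  actWord≡signedLetters : ∀ {w} (σ : Vec (SVal (length w)) (length w)) →
                          actWord σ w ≡ word 1# (map (signedLetter w) (Vec.toList σ))
  actWord≡signedLetters {w} σ with length w ℕ.≟ length w
  ... | no  ≢ = ⊥-elim (≢ refl)
  ... | yes e = cong (word 1#) (trans (Vecₚ.toList-map _ σ) (Listₚ.map-cong letter≗ (Vec.toList σ)))
    where
      letter≗ : ∀ s → _ ≡ signedLetter w s
      letter≗ (true  , j) = cong (List.lookup w) (Finₚ.cast-is-id (sym e) j)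
      letter≗ (false , j) = cong (bar ∘ List.lookup w) (Finₚ.cast-is-id (sym e) j)

  map-signedLetter-sucS : ∀ z w xs → map (signedLetter (z ∷ w)) (map sucS xs) ≡ map (signedLetter w) xs
  map-signedLetter-sucS z w xs =
    trans (sym (Listₚ.map-∘ xs)) (Listₚ.map-cong (λ { (true , _) → refl ; (false , _) → refl }) xs)

  splittings-as-subsets : ∀ {j} (F : Word → Word → FT j) w →
                          concatMap (uncurry λ x y → F (barW x) y) (splittings w)
                            ∼ concatMap (λ c → F (map (signedLetter w) (negEntries c)) (map (signedLetter w) (posEntries c)))
                                        (allVecs bools (length w))
  splittings-as-subsets F []      = ∼-refl
  splittings-as-subsets F (z ∷ w) = begin
    concatMap (uncurry λ x y → F (barW x) y) (concatMap (insert z) (splittings w))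
      ≡⟨ concatMap-insert (λ x y → F (barW x) y) z (splittings w) ⟩
    concatMap (uncurry λ x y → F (barW (z ∷ x)) y ++ F (barW x) (z ∷ y)) (splittings w)
      ≡⟨ Listₚ.concatMap-cong (λ (x , y) → cong (λ x̄ → F x̄ y ++ F (barW x) (z ∷ y)) (barW-∷ z x))
                              (splittings w) ⟩
    concatMap (uncurry λ x y → F₁ (barW x) y ++ F₂ (barW x) y) (splittings w)
      ≈⟨ concatMap-++-distrib (uncurry λ x y → F₁ (barW x) y) (uncurry λ x y → F₂ (barW x) y) (splittings w) ⟩
    concatMap (uncurry λ x y → F₁ (barW x) y) (splittings w) ++ concatMap (uncurry λ x y → F₂ (barW x) y) (splittings w)
      ≈⟨ ∼-++ (splittings-as-subsets F₁ w) (splittings-as-subsets F₂ w) ⟩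
    concatMap (λ c → F₁ (negLetters c) (posLetters c)) subsets
      ++ concatMap (λ c → F₂ (negLetters c) (posLetters c)) subsets
      ≡⟨ trans (concatMap-concatMap G (λ b → map (b ∷_) subsets) bools)
               (cong₂ _++_ (trans (Listₚ.concatMap-map G _ subsets) (Listₚ.concatMap-cong G-true subsets))
                           (trans (Listₚ.++-identityʳ _)
                                  (trans (Listₚ.concatMap-map G _ subsets) (Listₚ.concatMap-cong G-false subsets)))) ⟨
    concatMap G (allVecs bools (suc (length w)))
      ∎
    where
      subsets = allVecs bools (length w)
      negLetters posLetters : Vec Bool (length w) → Word
      negLetters c = map (signedLetter w) (negEntries c)
      posLetters c = map (signedLetter w) (posEntries c)
      F₁ F₂ : Word → Word → FT _
      F₁ x y = F (x ++ bar z ∷ []) y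
      F₂ x y = F x (z ∷ y)
      G : Vec Bool (suc (length w)) → FT _
      G c = F (map (signedLetter (z ∷ w)) (negEntries c)) (map (signedLetter (z ∷ w)) (posEntries c))
      G-true : ∀ c → G (true ∷ c) ≡ F₁ (negLetters c) (posLetters c)
      G-true c = cong₂ F (trans (Listₚ.map-++ _ (map sucS (negEntries c)) _)
                                (cong (_++ bar z ∷ []) (map-signedLetter-sucS z w (negEntries c))))
                         (map-signedLetter-sucS z w (posEntries c))
      G-false : ∀ c → G (false ∷ c) ≡ F₂ (negLetters c) (posLetters c)
      G-false c = cong₂ F (map-signedLetter-sucS z w (negEntries c))
                          (cong (z ∷_) (map-signedLetter-sucS z w (posEntries c)))

  actX0-word : ∀ {n} w → length w ≡ n → concatMap (λ σ → actWord σ w) (X0-set n) ∼ bar⋆idʷ 1# w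
  actX0-word w refl = begin
    concatMap (λ σ → actWord σ w) (X0-set (length w))
      ≈⟨ concatMap-↭ (λ σ → actWord σ w) (X0-set↭fromSubsets (length w)) ⟩
    concatMap (λ σ → actWord σ w) (map fromSubset subsets)
      ≡⟨ trans (Listₚ.concatMap-map _ fromSubset subsets) (Listₚ.concatMap-cong act-fromSubset subsets) ⟩
    concatMap (λ c → word 1# (map (signedLetter w) (negEntries c) ++ map (signedLetter w) (posEntries c))) subsets
      ≈⟨ splittings-as-subsets (λ x y → word 1# (x ++ y)) w ⟨
    bar⋆idʷ 1# w
      ∎
    where
      subsets = allVecs bools (length w)
      act-fromSubset : ∀ c → actWord (fromSubset c) w
                               ≡ word 1# (map (signedLetter w) (negEntries c) ++ map (signedLetter w) (posEntries c))
      act-fromSubset c = trans (actWord≡signedLetters (fromSubset c))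
        (cong (word 1#) (trans (cong (map (signedLetter w)) (toList-fromSubset c)) (Listₚ.map-++ _ (negEntries c) _)))

  act-∑ : ∀ {n} P (σ : Vec (SVal n) n) → act P σ ≡ ∑[ r · w ∈ P ] ∑[ s · v ∈ actWord σ w ] word (r * s) v
  act-∑ P σ = Listₚ.concatMap-cong (λ { (r , w ∷ []) → map-as-∑ _ _ (λ _ _ → refl) (actWord σ w) }) P

  actX0≈bar⋆id : ∀ {n} P → Homogeneous n P → actX0 n P ∼ bar⋆id P
  actX0≈bar⋆id {n} P hom = begin
    actX0 n P                                                     ≡⟨ Listₚ.concatMap-cong (act-∑ P) (X0-set n) ⟩
    concatMap (λ σ → ∑[ r · w ∈ P ] scaledAct r w σ) (X0-set n)   ≈⟨ ∑-concatMap-comm P (X0-set n) scaledAct ⟨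
    ∑[ r · w ∈ P ] concatMap (scaledAct r w) (X0-set n)           ≈⟨ ∑-cong-homogeneous P hom per-word ⟩
    bar⋆id P                                                      ∎
    where
      scaledAct : K → Word → Vec (SVal n) n → T
      scaledAct r w σ = concatMap (wordMap₁ (r *_) (λ v → v)) (actWord σ w)
      per-word : ∀ r w → length w ≡ n → concatMap (scaledAct r w) (X0-set n) ∼ bar⋆idʷ r w
      per-word r w |w| = begin
        concatMap (scaledAct r w) (X0-set n)
          ≡⟨ concatMap-concatMap (wordMap₁ (r *_) (λ v → v)) (λ σ → actWord σ w) (X0-set n) ⟨
        concatMap (wordMap₁ (r *_) (λ v → v)) (concatMap (λ σ → actWord σ w) (X0-set n))
          ≈⟨ concatMap-resp (wordMap₁-linear (*ˡ-isKLinear r) (prefix-isLinearInEachLetter [])) (actX0-word w |w|) ⟩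
        concatMap (wordMap₁ (r *_) (λ v → v)) (bar⋆idʷ 1# w)
          ≡⟨ trans (concatMap-concatMap _ _ (splittings w))
                   (Listₚ.concatMap-cong (λ _ → Listₚ.++-identityʳ _) (splittings w)) ⟩
        concatMap (uncurry λ x y → word (r * 1#) (barW x ++ y)) (splittings w)
          ≈⟨ concatMap-∼ (λ _ → word-scal _ (*-identityʳ r)) (splittings w) ⟩
        bar⋆idʷ r w
          ∎

open import Data.Nat using (_+_)

proposition7p1 : {c ℓ m ℓm : Level}
  (R : CommutativeRing c ℓ) → IsField R → CharNot2 R →
  (M : Module R m ℓm) →
  (bar : Module.Carrierᴹ M → Module.Carrierᴹ M) → IsLinearInvolution R M bar →
  let open TensorAlgebra R M in
  let open WithInvolution bar in
  (p₁ : T) (d₁ : ℕ) (rest : List (T × ℕ)) →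
  Homogeneous d₁ p₁ → IsLiePoly p₁ →
  All (λ q → Homogeneous (proj₂ q) (proj₁ q)) rest →
  All (λ q → IsLiePoly (proj₁ q)) rest →
  let n = d₁ + foldr _+_ 0 (map proj₂ rest) in
  let ps = map proj₁ rest in
  (actX0 n (prodList p₁ ps) ∼ nested∇ p₁ ps)
  × (barT p₁ ∼ -T p₁ → actX0 n (prodList p₁ ps) ∼ 0T)
proposition7p1 R _ _ M bar bar-involution p₁ d₁ rest hom₁ lie₁ homs lies = identity , vanishing
  where
    open TensorAlgebra R M
    open WithInvolution bar
    open FormalSums R M
    open Conjugation R M bar bar-involution
    open Convolution R M bar bar-involution
    open ActionOfX0 R M bar bar-involution
    ps = map proj₁ rest
    n = d₁ + foldr _+_ 0 (map proj₂ rest)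
    identity : actX0 n (prodList p₁ ps) ∼ nested∇ p₁ ps
    identity = begin
      actX0 n (prodList p₁ ps)
        ≈⟨ actX0≈bar⋆id (prodList p₁ ps) (foldl-*T-homogeneous rest hom₁ homs) ⟩
      bar⋆id (prodList p₁ ps)
        ≈⟨ bar⋆id-foldl ps (Allₚ.map⁺ lies) (bar⋆id-primitive p₁ lie₁) (barT-∇ p₁) ⟩
      nested∇ p₁ ps
        ∎
    vanishing : barT p₁ ∼ -T p₁ → actX0 n (prodList p₁ ps) ∼ 0T
    vanishing p̄₁∼-p₁ = begin
      actX0 n (prodList p₁ ps)
        ≈⟨ identity ⟩
      foldl ∇-step (∇ p₁) ps
        ≈⟨ foldl-∇-step-cong ps (∼-trans (++-congˡ p₁ p̄₁∼-p₁) (+T-inverseʳ p₁)) ⟩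
      foldl ∇-step 0T ps
        ≡⟨ foldl-∇-step-0T ps ⟩
      0T
        ∎
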